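{- For every $n\ge2$ there is a bijection $f_2:\mathcal{T}_2\cap\mathcal{A}_n\to\{(i,s):s\in\mathcal{A}^*\cap\mathcal{A}_{n-1},\ \mathrm{rpos}(s)\le i<\mathrm{rmin}(s)\}$ of the form $f_2(s)=(\mathrm{rpos}(s),s^*)$ such that $\mathrm{asc}(s)=\mathrm{asc}(s^*)$, $\max(s)=\max(s^*)$, $\mathrm{ealm}(s)=\mathrm{ealm}(s^*)$, $\mathrm{rmin}(s)=\mathrm{rmin}(s^*)$, $\mathrm{zero}(s)=\mathrm{zero}(s^*)+\chi(\mathrm{rpos}(s)=0)$ and $\mathrm{rep}(s)=\mathrm{rep}(s^*)+1$.
   Context: Inversion sequence: $s=(s_1,\dots,s_n)$, $0\le s_i<i$, $|s|=n$. $\mathrm{asc}(s)=|\{i:s_i<s_{i+1}\}|$. Ascent sequence: $s_i\le\mathrm{asc}(s_1,\dots,s_{i-1})+1$ for $i\ge2$; $\mathcal{A}_n$ = ascent sequences of length $n$; $\mathcal{A}^*$ = all ascent sequences except those of the form $(0,1,\dots,|s|-1)$. $\mathrm{rep}(s)=n-|\{s_i\}|$, $\mathrm{zero}(s)=|\{i:s_i=0\}|$, $\max(s)=|\{i:s_i=i-1\}|$, $\mathrm{ealm}(s)=s_{\max(s)+1}$ if $\max(s)\neq|s|$ and $0$ otherwise. $\mathrm{Rmin}(s)=\{s_i:s_i<s_j\ \forall j>i\}$, $\mathrm{rmin}(s)=|\mathrm{Rmin}(s)|$, and $\mathrm{Rmin}(s)_j$ is its $j$-th smallest element, $0\le j<\mathrm{rmin}(s)$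 (the $j$-th right-to-left minimum, counted from $0$ from the left). $\mathrm{rpos}(s)$ is the maximal index $m$ such that the value $\mathrm{Rmin}(s)_m$ occurs at least twice after the position of the right-to-left minimum $\mathrm{Rmin}(s)_{m-1}$ (for $m=0$: at least twice in $s$); if none exists or $\mathrm{rmin}(s)=|s|$, $\mathrm{rpos}(s)=0$. $\mathrm{sebr}(s)$ for $s\in\mathcal{A}^*$ is the smallest entry strictly between the two rightmost occurrences of $\mathrm{Rmin}(s)_{\mathrm{rpos}(s)}$, and $\mathrm{sebr}(s)=0$ if these two occurrences are adjacent. $\mathcal{T}_1=\{s\in\mathcal{A}^*:|s|=\mathrm{rmin}(s)+1\}$ and $\mathcal{T}_2=\{s\in\mathcal{A}^*\setminus\mathcal{T}_1:\mathrm{sebr}(s)=0\}$. $\chi(P)=1$ if $P$ holds and $0$ otherwise. -}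

module Defs where

open import Data.Bool using (Bool; true; false; _∧_; _∨_; not; if_then_else_; T)
open import Data.Nat using (ℕ; zero; suc; _+_; _∸_; _≤_; _<_; _≡ᵇ_; _≤ᵇ_; _<ᵇ_; _⊓_)
open import Data.List using (List; []; _∷_; length; take; drop; filterᵇ; upTo; map; foldr)
open import Data.Bool.ListAction using (all; any)
open import Data.Maybe using (Maybe; just; nothing)
open import Data.Product using (Σ; _×_)
open import Relation.Binary.PropositionalEquality using (_≡_)

-- Sequences s = (s_1,…,s_n) are lists of naturals.
-- at s i  = s_{i+1}  (0-indexed access; default 0 out of range, never used out of range)
at : List ℕ → ℕ → ℕ
at []       _       = 0
at (x ∷ xs) zero    = x
at (x ∷ xs) (suc i) = at xs i

count : {A : Set} → (A → Bool) → List A → ℕ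
count p xs = length (filterᵇ p xs)

range : ℕ → ℕ → List ℕ
range a b = map (a +_) (upTo (b ∸ a))

asc : List ℕ → ℕ
asc s = count (λ i → at s i <ᵇ at s (suc i)) (upTo (length s ∸ 1))

isAscent : List ℕ → Bool
isAscent [] = true
isAscent s  = (at s 0 ≡ᵇ 0) ∧ all (λ i → at s i ≤ᵇ asc (take i s) + 1) (range 1 (length s))

isIdentity : List ℕ → Bool
isIdentity s = all (λ i → at s i ≡ᵇ i) (upTo (length s))

inAstar : List ℕ → Bool
inAstar s = isAscent s ∧ not (isIdentity s)

-- rep(s) = n − |{s_i}|  (distinct values counted via first occurrences)
rep : List ℕ → ℕ
rep s = length s ∸ count (λ i → not (any (λ j → at s j ≡ᵇ at s i) (upTo i))) (upTo (length s))

zeros : List ℕ → ℕ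
zeros s = count (λ v → v ≡ᵇ 0) s

-- max(s) = |{ i : s_i = i - 1 }|  (1-indexed)
maxs : List ℕ → ℕ
maxs s = count (λ i → at s i ≡ᵇ i) (upTo (length s))

ealm : List ℕ → ℕ
ealm s = if maxs s ≡ᵇ length s then 0 else at s (maxs s)

rlminPos : List ℕ → List ℕ
rlminPos s = filterᵇ (λ i → all (λ j → at s i <ᵇ at s j) (range (suc i) (length s)))
                     (upTo (length s))

-- Rmin(s) listed left to right; these values are strictly increasing,
-- so the j-th entry of this list is the j-th smallest element Rmin(s)_j.
Rmin : List ℕ → List ℕ
Rmin s = map (at s) (rlminPos s)

rmin : List ℕ → ℕ
rmin s = length (Rmin s)

lastOr0 : List ℕ → ℕ
lastOr0 xs with Data.List.last xs
... | just x  = x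
... | nothing = 0

rposOK : List ℕ → ℕ → Bool
rposOK s zero    = 2 ≤ᵇ count (λ v → v ≡ᵇ at (Rmin s) 0) s
rposOK s (suc m) = 2 ≤ᵇ count (λ j → at s j ≡ᵇ at (Rmin s) (suc m))
                              (range (suc (at (rlminPos s) m)) (length s))

rpos : List ℕ → ℕ
rpos s = if rmin s ≡ᵇ length s then 0 else lastOr0 (filterᵇ (rposOK s) (upTo (rmin s)))

minimumOr0 : List ℕ → ℕ
minimumOr0 []       = 0
minimumOr0 (x ∷ xs) = foldr _⊓_ x xs

-- sebr(s): smallest entry strictly between the two rightmost occurrences of
-- Rmin(s)_{rpos(s)}; 0 if they are adjacent (0 as a default if fewer than two
-- occurrences exist, which never happens on 𝒜* ∖ 𝒯₁).
sebr : List ℕ → ℕ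
sebr s = go (Data.List.reverse (filterᵇ (λ j → at s j ≡ᵇ at (Rmin s) (rpos s)) (upTo (length s))))
  where
  go : List ℕ → ℕ
  go (q ∷ p ∷ _) = if q ≡ᵇ suc p then 0 else minimumOr0 (map (at s) (range (suc p) q))
  go _           = 0

inT1 : List ℕ → Bool
inT1 s = inAstar s ∧ (length s ≡ᵇ suc (rmin s))

inT2 : List ℕ → Bool
inT2 s = inAstar s ∧ not (inT1 s) ∧ (sebr s ≡ᵇ 0)

χrpos0 : List ℕ → ℕ
χrpos0 s = if rpos s ≡ᵇ 0 then 1 else 0

Dom : ℕ → Set
Dom n = Σ (List ℕ) λ s → T (inT2 s) × length s ≡ n

Cod : ℕ → Set
Cod n = Σ ℕ λ i → Σ (List ℕ) λ s → T (inAstar s) × length s ≡ n ∸ 1 × rpos s ≤ i × i < rmin s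

module Submission where

-- Given (i, t) with t ∈ 𝒜* and rpos(t) ≤ i < rmin(t), let p be the position of the i-th
-- right-to-left minimum of t and let s be t with the entry t_p duplicated in place.  A repeated
-- entry creates no ascent, so s is again an ascent sequence with the same asc and the same
-- right-to-left minima (their positions after p shift by one); the new copy is a repetition, so
-- rep grows by one, and it is a zero exactly when i = 0, since the first right-to-left minimum of
-- an ascent sequence is its last zero.  The duplication makes i the largest index whose value
-- repeats after the previous right-to-left minimum, so rpos(s) = i, and the two rightmost
-- occurrences of that value are adjacent, so sebr(s) = 0 and s ∈ 𝒯₂.  The statistics max and ealm
-- survive because t_p ≠ p: otherwise t would begin with an identity block of right-to-left minima
-- of length p + 1, which forces rpos(t) > i.
-- Conversely, for s ∈ 𝒯₂ every entry strictly between the two rightmost occurrences of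
-- Rmin(s)_rpos(s) is positive (it exceeds the previous right-to-left minimum, or is nonzero when
-- rpos(s) = 0), so sebr(s) = 0 forces the two occurrences to be adjacent, and deleting one of them
-- inverts the construction.

open import Defs
open import Data.Bool using (Bool; true; false; _∧_; _∨_; not; if_then_else_; T)
open import Data.Bool.Properties using (∧-assoc; ∧-idem; ∨-assoc; ∨-idem; T-irrelevant)
open import Data.Bool.ListAction using (all; any)
open import Data.Empty using (⊥-elim)
open import Data.List using (List; []; _∷_; length; take; drop; filterᵇ; upTo; map; foldr; _++_; applyUpTo; reverse; last)
open import Data.List.Properties using (map-++; length-++; length-map; length-drop; length-upTo; map-∘; map-cong-local; take-all; take-take; drop-all; ++-identityʳ; reverse-++)
open import Data.List.Relation.Unary.All as All using (All; []; _∷_)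
import Data.List.Relation.Unary.All.Properties as Allₚ
open import Data.Maybe using (just)
open import Data.Nat using (ℕ; zero; suc; _+_; _∸_; _≤_; _<_; _≡ᵇ_; _≤ᵇ_; _<ᵇ_; _⊓_; z≤n; s≤s; pred)
open import Data.Nat.Properties
open import Data.Product using (Σ; _×_; _,_; proj₁; proj₂)
open import Data.Sum using (inj₁; inj₂)
open import Data.Unit using (tt)
open import Function using (_∘_; id)
open import Function.Bundles using (_⤖_; Bijection; mk↔ₛ′)
open import Function.Properties.Inverse using (↔⇒⤖)
open import Relation.Binary using (tri<; tri≈; tri>)
open import Relation.Binary.PropositionalEquality
open import Relation.Nullary using (¬_; yes; no)

T⇒≡true : ∀ {b} → T b → b ≡ true
T⇒≡true {true} _ = refl

≡true⇒T : ∀ {b} → b ≡ true → T b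
≡true⇒T refl = tt

true≢false : ¬ (true ≡ false)
true≢false ()

not≡true⇒≡false : ∀ {b} → not b ≡ true → b ≡ false
not≡true⇒≡false {false} _ = refl

≡true-⇔⇒≡ : ∀ {a b : Bool} → (a ≡ true → b ≡ true) → (b ≡ true → a ≡ true) → a ≡ b
≡true-⇔⇒≡ {true} {true} f g = refl
≡true-⇔⇒≡ {true} {false} f g = sym (f refl)
≡true-⇔⇒≡ {false} {true} f g = g refl
≡true-⇔⇒≡ {false} {false} f g = refl

∧≡true⇒ˡ : ∀ {a b} → a ∧ b ≡ true → a ≡ true
∧≡true⇒ˡ {true} e = refl

∧≡true⇒ʳ : ∀ {a b} → a ∧ b ≡ true → b ≡ true
∧≡true⇒ʳ {true} e = e

∧≡true : ∀ {a b} → a ≡ true → b ≡ true → a ∧ b ≡ true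
∧≡true refl refl = refl

≤⇒≤ᵇ≡true : ∀ {m n} → m ≤ n → (m ≤ᵇ n) ≡ true
≤⇒≤ᵇ≡true h = T⇒≡true (≤⇒≤ᵇ h)

≤ᵇ≡true⇒≤ : ∀ m n → (m ≤ᵇ n) ≡ true → m ≤ n
≤ᵇ≡true⇒≤ m n e = ≤ᵇ⇒≤ m n (≡true⇒T e)

<⇒<ᵇ≡true : ∀ {m n} → m < n → (m <ᵇ n) ≡ true
<⇒<ᵇ≡true h = T⇒≡true (<⇒<ᵇ h)

<ᵇ≡true⇒< : ∀ m n → (m <ᵇ n) ≡ true → m < n
<ᵇ≡true⇒< m n e = <ᵇ⇒< m n (≡true⇒T e)

≡⇒≡ᵇ≡true : ∀ {m n} → m ≡ n → (m ≡ᵇ n) ≡ true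
≡⇒≡ᵇ≡true {m} {n} h = T⇒≡true (≡⇒≡ᵇ m n h)

≡ᵇ≡true⇒≡ : ∀ m n → (m ≡ᵇ n) ≡ true → m ≡ n
≡ᵇ≡true⇒≡ m n e = ≡ᵇ⇒≡ m n (≡true⇒T e)

≤⇒<ᵇ≡false : ∀ {m n} → n ≤ m → (m <ᵇ n) ≡ false
≤⇒<ᵇ≡false {m} {n} h with m <ᵇ n in eq
... | true = ⊥-elim (<⇒≱ (<ᵇ≡true⇒< m n eq) h)
... | false = refl

<ᵇ≡false⇒≥ : ∀ m n → (m <ᵇ n) ≡ false → n ≤ m
<ᵇ≡false⇒≥ m n e with m <? n
... | yes m<n = ⊥-elim (subst T e (<⇒<ᵇ m<n))
... | no m≮n = ≮⇒≥ m≮n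

≢⇒≡ᵇ≡false : ∀ {m n} → ¬ (m ≡ n) → (m ≡ᵇ n) ≡ false
≢⇒≡ᵇ≡false {m} {n} h with m ≡ᵇ n in eq
... | true = ⊥-elim (h (≡ᵇ≡true⇒≡ m n eq))
... | false = refl

≡ᵇ≡false⇒≢ : ∀ m n → (m ≡ᵇ n) ≡ false → ¬ (m ≡ n)
≡ᵇ≡false⇒≢ m n e h = subst T e (≡⇒≡ᵇ m n h)

<ᵇ-irrefl : ∀ x → (x <ᵇ x) ≡ false
<ᵇ-irrefl x = ≤⇒<ᵇ≡false {x} {x} ≤-refl

m∸n≡suc[m∸1+n] : ∀ m n → n < m → m ∸ n ≡ suc (m ∸ suc n)
m∸n≡suc[m∸1+n] m n n<m = +-∸-assoc 1 n<m

χ : Bool → ℕ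
χ b = if b then 1 else 0

count-∷ : ∀ {A : Set} (q : A → Bool) x xs → count q (x ∷ xs) ≡ χ (q x) + count q xs
count-∷ q x xs with q x
... | true = refl
... | false = refl

count≤length : ∀ {A : Set} (p : A → Bool) xs → count p xs ≤ length xs
count≤length p [] = z≤n
count≤length p (x ∷ xs) with p x
... | true = s≤s (count≤length p xs)
... | false = m≤n⇒m≤1+n (count≤length p xs)

count-false : ∀ {A : Set} (xs : List A) → count (λ _ → false) xs ≡ 0
count-false [] = refl
count-false (x ∷ xs) = count-false xs

filterᵇ-accept : ∀ {A : Set} (p : A → Bool) x xs → p x ≡ true → filterᵇ p (x ∷ xs) ≡ x ∷ filterᵇ p xs
filterᵇ-accept p x xs e with p x
... | true = refl

filterᵇ-reject : ∀ {A : Set} (p : A → Bool) x xs → p x ≡ false → filterᵇ p (x ∷ xs) ≡ filterᵇ p xs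
filterᵇ-reject p x xs e with p x
... | false = refl

filterᵇ-++ : ∀ {A : Set} (p : A → Bool) xs ys → filterᵇ p (xs ++ ys) ≡ filterᵇ p xs ++ filterᵇ p ys
filterᵇ-++ p [] ys = refl
filterᵇ-++ p (x ∷ xs) ys with p x
... | true = cong (x ∷_) (filterᵇ-++ p xs ys)
... | false = filterᵇ-++ p xs ys

filterᵇ-map : ∀ {A B : Set} (p : B → Bool) (f : A → B) xs → filterᵇ p (map f xs) ≡ map f (filterᵇ (p ∘ f) xs)
filterᵇ-map p f [] = refl
filterᵇ-map p f (x ∷ xs) with p (f x)
... | true = cong (f x ∷_) (filterᵇ-map p f xs)
... | false = filterᵇ-map p f xs

filterᵇ-false : ∀ {A : Set} (xs : List A) → filterᵇ (λ _ → false) xs ≡ []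
filterᵇ-false [] = refl
filterᵇ-false (x ∷ xs) = filterᵇ-false xs

count-++ : ∀ {A : Set} (p : A → Bool) xs ys → count p (xs ++ ys) ≡ count p xs + count p ys
count-++ p xs ys = trans (cong length (filterᵇ-++ p xs ys)) (length-++ (filterᵇ p xs))

count-map : ∀ {A B : Set} (p : B → Bool) (f : A → B) xs → count p (map f xs) ≡ count (p ∘ f) xs
count-map p f xs = trans (cong length (filterᵇ-map p f xs)) (length-map f (filterᵇ (p ∘ f) xs))

all-map : ∀ {A B : Set} (p : B → Bool) (f : A → B) xs → all p (map f xs) ≡ all (p ∘ f) xs
all-map p f [] = refl
all-map p f (x ∷ xs) = cong (p (f x) ∧_) (all-map p f xs)

any-map : ∀ {A B : Set} (p : B → Bool) (f : A → B) xs → any p (map f xs) ≡ any (p ∘ f) xs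
any-map p f [] = refl
any-map p f (x ∷ xs) = cong (p (f x) ∨_) (any-map p f xs)

any-∷ʳ-self : ∀ (xs : List ℕ) x → any (_≡ᵇ x) (xs ++ x ∷ []) ≡ true
any-∷ʳ-self [] x rewrite ≡⇒≡ᵇ≡true {x} {x} refl = refl
any-∷ʳ-self (y ∷ xs) x with y ≡ᵇ x
... | true = refl
... | false = any-∷ʳ-self xs x

at-++ˡ : ∀ xs ys i → i < length xs → at (xs ++ ys) i ≡ at xs i
at-++ˡ (x ∷ xs) ys zero _ = refl
at-++ˡ (x ∷ xs) ys (suc i) (s≤s h) = at-++ˡ xs ys i h

at-++ʳ : ∀ xs ys i → at (xs ++ ys) (length xs + i) ≡ at ys i
at-++ʳ [] ys i = refl
at-++ʳ (x ∷ xs) ys i = at-++ʳ xs ys i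

at-map : ∀ (f : ℕ → ℕ) xs i → i < length xs → at (map f xs) i ≡ f (at xs i)
at-map f (x ∷ xs) zero _ = refl
at-map f (x ∷ xs) (suc i) (s≤s h) = at-map f xs i h

at⇒count-pos : ∀ (q : ℕ → Bool) t p → p < length t → q (at t p) ≡ true → 1 ≤ count q t
at⇒count-pos q (x ∷ t) zero h e with q x
... | true = s≤s z≤n
at⇒count-pos q (x ∷ t) (suc p) (s≤s h) e with q x
... | true = s≤s z≤n
... | false = at⇒count-pos q t p h e

length-take-≤ : ∀ {A : Set} k (xs : List A) → k ≤ length xs → length (take k xs) ≡ k
length-take-≤ zero xs h = refl
length-take-≤ (suc k) (x ∷ xs) (s≤s h) = cong suc (length-take-≤ k xs h)

at-take : ∀ xs k i → i < k → at (take k xs) i ≡ at xs i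
at-take [] zero i h = refl
at-take [] (suc k) i h = refl
at-take (x ∷ xs) (suc k) zero h = refl
at-take (x ∷ xs) (suc k) (suc i) (s≤s h) = at-take xs k i h

at-drop : ∀ xs k i → at (drop k xs) i ≡ at xs (k + i)
at-drop xs zero i = refl
at-drop [] (suc k) i = refl
at-drop (x ∷ xs) (suc k) i = at-drop xs k i

at-drop-∸ : ∀ xs {k p} → k ≤ p → at (drop k xs) (p ∸ k) ≡ at xs p
at-drop-∸ xs {k} {p} h = trans (at-drop xs k (p ∸ k)) (cong (at xs) (m+[n∸m]≡n h))

drop≡at∷drop : ∀ xs k → k < length xs → drop k xs ≡ at xs k ∷ drop (suc k) xs
drop≡at∷drop (x ∷ xs) zero h = refl
drop≡at∷drop (x ∷ xs) (suc k) (s≤s h) = drop≡at∷drop xs k h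

take-suc≡take∷ʳat : ∀ xs k → k < length xs → take (suc k) xs ≡ take k xs ++ at xs k ∷ []
take-suc≡take∷ʳat (x ∷ xs) zero h = refl
take-suc≡take∷ʳat (x ∷ xs) (suc k) (s≤s h) = cong (x ∷_) (take-suc≡take∷ʳat xs k h)

length-drop-suc> : ∀ p k (t : List ℕ) → k < p → p < length t → p ∸ suc k < length (drop (suc k) t)
length-drop-suc> p k t k<p pl = subst (p ∸ suc k <_) (sym (length-drop (suc k) t)) (∸-monoˡ-< pl k<p)

All-at : ∀ {Q : ℕ → Set} xs j → All Q xs → j < length xs → Q (at xs j)
All-at (x ∷ xs) zero (q ∷ qs) h = q
All-at (x ∷ xs) (suc j) (q ∷ qs) (s≤s h) = All-at xs j qs h

foldr-⊓-pos : ∀ x xs → 0 < x → All (0 <_) xs → 0 < foldr _⊓_ x xs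
foldr-⊓-pos x [] 0<x [] = 0<x
foldr-⊓-pos x (y ∷ ys) 0<x (0<y ∷ 0<ys) = ⊓-pos 0<y (foldr-⊓-pos x ys 0<x 0<ys)
  where
  ⊓-pos : ∀ {a b} → 0 < a → 0 < b → 0 < a ⊓ b
  ⊓-pos {suc a} {suc b} _ _ = s≤s z≤n

segment : ℕ → ℕ → List ℕ
segment a zero = []
segment a (suc k) = a ∷ segment (suc a) k

upTo≡segment : ∀ k → upTo k ≡ segment 0 k
upTo≡segment k = applyUpTo-segment id 0 k (λ i → refl)
  where
  applyUpTo-segment : ∀ (f : ℕ → ℕ) a k → (∀ i → f i ≡ a + i) → applyUpTo f k ≡ segment a k
  applyUpTo-segment f a zero h = refl
  applyUpTo-segment f a (suc k) h = cong₂ _∷_ (trans (h 0) (+-identityʳ a))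
    (applyUpTo-segment (f ∘ suc) (suc a) k (λ i → trans (h (suc i)) (+-suc a i)))

map-+-segment : ∀ a b k → map (a +_) (segment b k) ≡ segment (a + b) k
map-+-segment a b zero = refl
map-+-segment a b (suc k) = cong (a + b ∷_) (trans (map-+-segment a (suc b) k) (cong (λ x → segment x k) (+-suc a b)))

range≡segment : ∀ a b → range a b ≡ segment a (b ∸ a)
range≡segment a b = trans (cong (map (a +_)) (upTo≡segment (b ∸ a)))
                      (trans (map-+-segment a 0 (b ∸ a)) (cong (λ x → segment x (b ∸ a)) (+-identityʳ a)))

segment-++ : ∀ a k l → segment a (k + l) ≡ segment a k ++ segment (a + k) l
segment-++ a zero l = cong (λ x → segment x l) (sym (+-identityʳ a))
segment-++ a (suc k) l = cong (a ∷_) (trans (segment-++ (suc a) k l) (cong (λ x → segment (suc a) k ++ segment x l) (sym (+-suc a k))))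

segment-suc : ∀ a k → segment a (suc k) ≡ segment a k ++ (a + k) ∷ []
segment-suc a k = trans (cong (segment a) (+-comm 1 k)) (segment-++ a k 1)

map-suc-segment : ∀ a k → map suc (segment a k) ≡ segment (suc a) k
map-suc-segment a zero = refl
map-suc-segment a (suc k) = cong (suc a ∷_) (map-suc-segment (suc a) k)

length-segment : ∀ a k → length (segment a k) ≡ k
length-segment a zero = refl
length-segment a (suc k) = cong suc (length-segment (suc a) k)

at-segment : ∀ a k i → i < k → at (segment a k) i ≡ a + i
at-segment a (suc k) zero h = sym (+-identityʳ a)
at-segment a (suc k) (suc i) (s≤s h) = trans (at-segment (suc a) k i h) (sym (+-suc a i))

segment-split : ∀ a k m → a ≤ m → m ≤ a + k → segment a k ≡ segment a (m ∸ a) ++ segment m (a + k ∸ m)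
segment-split a k m a≤m m≤a+k =
  trans (cong (segment a) (sym lengths)) (trans (segment-++ a (m ∸ a) (a + k ∸ m)) (cong (λ x → segment a (m ∸ a) ++ segment x (a + k ∸ m)) (m+[n∸m]≡n a≤m)))
  where
  lengths : (m ∸ a) + (a + k ∸ m) ≡ k
  lengths = begin
      (m ∸ a) + (a + k ∸ m) ≡⟨ sym (+-∸-assoc (m ∸ a) m≤a+k) ⟩
      (m ∸ a) + (a + k) ∸ m ≡⟨ cong (_∸ m) (+-comm (m ∸ a) (a + k)) ⟩
      (a + k) + (m ∸ a) ∸ m ≡⟨ cong (_∸ m) (+-assoc a k (m ∸ a)) ⟩
      a + (k + (m ∸ a)) ∸ m ≡⟨ cong (λ x → a + x ∸ m) (+-comm k (m ∸ a)) ⟩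
      a + ((m ∸ a) + k) ∸ m ≡⟨ cong (_∸ m) (sym (+-assoc a (m ∸ a) k)) ⟩
      a + (m ∸ a) + k ∸ m   ≡⟨ cong (λ x → x + k ∸ m) (m+[n∸m]≡n a≤m) ⟩
      m + k ∸ m             ≡⟨ m+n∸m≡n m k ⟩
      k                     ∎
    where open ≡-Reasoning

All-segment : ∀ (Q : ℕ → Set) a k → (∀ i → a ≤ i → i < a + k → Q i) → All Q (segment a k)
All-segment Q a zero h = []
All-segment Q a (suc k) h = h a ≤-refl (subst (a <_) (sym (+-suc a k)) (s≤s (m≤m+n a k))) ∷
  All-segment Q (suc a) k (λ i a<i i< → h i (<⇒≤ a<i) (subst (i <_) (sym (+-suc a k)) i<))

filterᵇ-cong-segment : ∀ (p q : ℕ → Bool) a k → (∀ i → a ≤ i → i < a + k → p i ≡ q i) → filterᵇ p (segment a k) ≡ filterᵇ q (segment a k)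
filterᵇ-cong-segment p q a zero h = refl
filterᵇ-cong-segment p q a (suc k) h with p a | q a | h a ≤-refl (subst (a <_) (sym (+-suc a k)) (m≤m+n (suc a) k))
... | true | true | _ = cong (a ∷_) (filterᵇ-cong-segment p q (suc a) k (λ i a<i i< → h i (<⇒≤ a<i) (subst (i <_) (sym (+-suc a k)) i<)))
... | false | false | _ = filterᵇ-cong-segment p q (suc a) k (λ i a<i i< → h i (<⇒≤ a<i) (subst (i <_) (sym (+-suc a k)) i<))

count-cong-segment : ∀ (p q : ℕ → Bool) a k → (∀ i → a ≤ i → i < a + k → p i ≡ q i) → count p (segment a k) ≡ count q (segment a k)
count-cong-segment p q a k h = cong length (filterᵇ-cong-segment p q a k h)

all-segment-intro : ∀ (p : ℕ → Bool) a k → (∀ i → a ≤ i → i < a + k → p i ≡ true) → all p (segment a k) ≡ true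
all-segment-intro p a zero h = refl
all-segment-intro p a (suc k) h rewrite h a ≤-refl (subst (a <_) (sym (+-suc a k)) (m≤m+n (suc a) k)) =
  all-segment-intro p (suc a) k (λ i a<i i< → h i (<⇒≤ a<i) (subst (i <_) (sym (+-suc a k)) i<))

all-segment-elim : ∀ (p : ℕ → Bool) a k → all p (segment a k) ≡ true → ∀ i → a ≤ i → i < a + k → p i ≡ true
all-segment-elim p a zero h i a≤i i< = ⊥-elim (<⇒≱ i< (subst (_≤ i) (sym (+-identityʳ a)) a≤i))
all-segment-elim p a (suc k) h i a≤i i< with p a in eq
all-segment-elim p a (suc k) h i a≤i i< | true with m≤n⇒m<n∨m≡n a≤i
... | inj₁ a<i = all-segment-elim p (suc a) k h i a<i (subst (i <_) (+-suc a k) i<)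
... | inj₂ refl = eq
all-segment-elim p a (suc k) () i a≤i i< | false

all-segment-false-witness : ∀ (P : ℕ → Bool) a k → all P (segment a k) ≡ false → Σ ℕ λ j → a ≤ j × j < a + k × P j ≡ false
all-segment-false-witness P a zero ()
all-segment-false-witness P a (suc k) h with P a in pa
... | false = a , ≤-refl , subst (a <_) (sym (+-suc a k)) (s≤s (m≤m+n a k)) , pa
... | true = let (j , h1 , h2 , h3) = all-segment-false-witness P (suc a) k h in j , <⇒≤ h1 , subst (j <_) (sym (+-suc a k)) h2 , h3

SelectedIn : (ℕ → Bool) → ℕ → ℕ → ℕ → Set
SelectedIn P a k x = a ≤ x × x < a + k × P x ≡ true

SelectedIn-suc : ∀ P a k {x} → SelectedIn P (suc a) k x → SelectedIn P a (suc k) x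
SelectedIn-suc P a k {x} (a<x , x<a+k , Px) = <⇒≤ a<x , subst (x <_) (sym (+-suc a k)) x<a+k , Px

filterᵇ-segment-All : ∀ (P : ℕ → Bool) a k → All (SelectedIn P a k) (filterᵇ P (segment a k))
filterᵇ-segment-All P a zero = []
filterᵇ-segment-All P a (suc k) with P a in eq
... | true = (≤-refl , subst (a <_) (sym (+-suc a k)) (s≤s (m≤m+n a k)) , eq) ∷ All.map (SelectedIn-suc P a k) (filterᵇ-segment-All P (suc a) k)
... | false = All.map (SelectedIn-suc P a k) (filterᵇ-segment-All P (suc a) k)

StrictlyIncreasing : List ℕ → Set
StrictlyIncreasing xs = ∀ j j' → j < j' → j' < length xs → at xs j < at xs j'

filterᵇ-segment-increasing : ∀ (P : ℕ → Bool) a k → StrictlyIncreasing (filterᵇ P (segment a k))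
filterᵇ-segment-increasing P a zero j j' h ()
filterᵇ-segment-increasing P a (suc k) with P a
... | false = filterᵇ-segment-increasing P (suc a) k
... | true = go
  where
  L : List ℕ
  L = filterᵇ P (segment (suc a) k)
  go : StrictlyIncreasing (a ∷ L)
  go zero (suc j') h (s≤s h') = proj₁ (All-at L j' (filterᵇ-segment-All P (suc a) k) h')
  go (suc j) (suc j') (s≤s h) (s≤s h') = filterᵇ-segment-increasing P (suc a) k j j' h h'

increasing-injective : ∀ xs → StrictlyIncreasing xs → ∀ j j' → j < length xs → j' < length xs → at xs j ≡ at xs j' → j ≡ j'
increasing-injective xs inc j j' hj hj' e with <-cmp j j'
... | tri< a _ _ = ⊥-elim (<-irrefl e (inc j j' a hj'))
... | tri≈ _ b _ = b
... | tri> _ _ c = ⊥-elim (<-irrefl (sym e) (inc j' j c hj))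

count-segment-witness : ∀ (P : ℕ → Bool) a k → 1 ≤ count P (segment a k) → Σ ℕ λ j → a ≤ j × j < a + k × P j ≡ true
count-segment-witness P a zero ()
count-segment-witness P a (suc k) h with P a in pa
... | true = a , ≤-refl , subst (a <_) (sym (+-suc a k)) (s≤s (m≤m+n a k)) , pa
... | false = let (j , h1 , h2 , h3) = count-segment-witness P (suc a) k h in j , <⇒≤ h1 , subst (j <_) (sym (+-suc a k)) h2 , h3

witness⇒count-segment-pos : ∀ (P : ℕ → Bool) a k j → a ≤ j → j < a + k → P j ≡ true → 1 ≤ count P (segment a k)
witness⇒count-segment-pos P a k j aj ja pj =
  at⇒count-pos P (segment a k) (j ∸ a) (subst (j ∸ a <_) (sym (length-segment a k)) lt)
    (trans (cong P (trans (at-segment a k (j ∸ a) lt) (m+[n∸m]≡n aj))) pj)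
  where
  lt : j ∸ a < k
  lt = subst (j ∸ a <_) (m+n∸m≡n a k) (∸-monoˡ-< ja aj)

count-segment-two : ∀ (P : ℕ → Bool) a k x y → a ≤ x → x < y → y < a + k → P x ≡ true → P y ≡ true → 2 ≤ count P (segment a k)
count-segment-two P a zero x y ax xy ya px py = ⊥-elim (<-irrefl refl (≤-trans ya (subst (_≤ y) (sym (+-identityʳ a)) (≤-trans ax (<⇒≤ xy)))))
count-segment-two P a (suc k) x y ax xy ya px py with m≤n⇒m<n∨m≡n ax
... | inj₂ refl rewrite px = s≤s (witness⇒count-segment-pos P (suc a) k y xy (subst (y <_) (+-suc a k) ya) py)
... | inj₁ ax' with P a
...   | true = s≤s (≤-trans (s≤s z≤n) (count-segment-two P (suc a) k x y ax' xy (subst (y <_) (+-suc a k) ya) px py))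
...   | false = count-segment-two P (suc a) k x y ax' xy (subst (y <_) (+-suc a k) ya) px py

count-segment-full : ∀ (P : ℕ → Bool) a k → k ≤ count P (segment a k) → ∀ i → a ≤ i → i < a + k → P i ≡ true
count-segment-full P a zero h i ai ia = ⊥-elim (<-irrefl refl (≤-trans ia (subst (_≤ i) (sym (+-identityʳ a)) ai)))
count-segment-full P a (suc k) h i ai ia with P a in pa
... | false = ⊥-elim (<-irrefl refl (≤-trans h (subst (count P (segment (suc a) k) ≤_) (length-segment (suc a) k) (count≤length P (segment (suc a) k)))))
... | true with m≤n⇒m<n∨m≡n ai
...   | inj₂ refl = pa
...   | inj₁ ai' = count-segment-full P (suc a) k (≤-pred h) i ai' (subst (i <_) (+-suc a k) ia)

count-segment-none : ∀ (P : ℕ → Bool) a k → (∀ i → a ≤ i → i < a + k → P i ≡ false) → count P (segment a k) ≡ 0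
count-segment-none P a k h = trans (count-cong-segment P (λ _ → false) a k h) (count-false (segment a k))

count-upTo-≤ : ∀ (Q : ℕ → Bool) n p → p ≤ n → (∀ i → p ≤ i → i < n → Q i ≡ false) → count Q (upTo n) ≤ p
count-upTo-≤ Q n p p≤n none = subst (_≤ p) (sym split) (subst (_≤ p) (sym (+-identityʳ _))
  (subst (count Q (segment 0 p) ≤_) (length-segment 0 p) (count≤length Q (segment 0 p))))
  where
  split : count Q (upTo n) ≡ count Q (segment 0 p) + 0
  split = trans (cong (count Q) (trans (upTo≡segment n) (segment-split 0 n p z≤n p≤n)))
    (trans (count-++ Q (segment 0 p) _) (cong (count Q (segment 0 p) +_)
      (count-segment-none Q p (n ∸ p) (λ i p≤i i< → none i p≤i (subst (i <_) (m+[n∸m]≡n p≤n) i<)))))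

filterᵇ-segment-all : ∀ (P : ℕ → Bool) a k → (∀ i → a ≤ i → i < a + k → P i ≡ true) → filterᵇ P (segment a k) ≡ segment a k
filterᵇ-segment-all P a zero h = refl
filterᵇ-segment-all P a (suc k) h = trans (filterᵇ-accept P a _ (h a ≤-refl (subst (a <_) (sym (+-suc a k)) (s≤s (m≤m+n a k)))))
  (cong (a ∷_) (filterᵇ-segment-all P (suc a) k (λ i ai ia → h i (<⇒≤ ai) (subst (i <_) (sym (+-suc a k)) ia))))

filterᵇ-segment-none : ∀ (P : ℕ → Bool) a k → (∀ i → a ≤ i → i < a + k → P i ≡ false) → filterᵇ P (segment a k) ≡ []
filterᵇ-segment-none P a k h = trans (filterᵇ-cong-segment P (λ _ → false) a k h) (filterᵇ-false (segment a k))

filterᵇ-segment-first : ∀ (P : ℕ → Bool) a k z → a ≤ z → z < a + k → (∀ l → a ≤ l → l < z → P l ≡ false) → P z ≡ true →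
  filterᵇ P (segment a k) ≡ z ∷ filterᵇ P (segment (suc z) (a + k ∸ suc z))
filterᵇ-segment-first P a zero z az za h pz = ⊥-elim (<-irrefl refl (≤-trans za (subst (_≤ z) (sym (+-identityʳ a)) az)))
filterᵇ-segment-first P a (suc k) z az za h pz with m≤n⇒m<n∨m≡n az
... | inj₂ refl = trans (filterᵇ-accept P a _ pz) (cong (λ m → a ∷ filterᵇ P (segment (suc a) m)) (sym (trans (cong (_∸ suc a) (+-suc a k)) (m+n∸m≡n a k))))
... | inj₁ az' = trans (filterᵇ-reject P a _ (h a ≤-refl az'))
   (trans (filterᵇ-segment-first P (suc a) k z az' (subst (z <_) (+-suc a k) za) (λ l al lz → h l (<⇒≤ al) lz) pz)
     (cong (λ m → z ∷ filterᵇ P (segment (suc z) (m ∸ suc z))) (sym (+-suc a k))))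

filterᵇ-segment-suc : ∀ (P : ℕ → Bool) r → filterᵇ P (segment 0 (suc r)) ≡ filterᵇ P (segment 0 r) ++ filterᵇ P (r ∷ [])
filterᵇ-segment-suc P r = trans (cong (filterᵇ P) (segment-suc 0 r)) (filterᵇ-++ P (segment 0 r) (r ∷ []))

filterᵇ-lastTwo : ∀ (P : ℕ → Bool) n q R → q < R → R < n → P q ≡ true → P R ≡ true →
  (∀ j → q < j → j < R → P j ≡ false) → (∀ j → R < j → j < n → P j ≡ false) →
  filterᵇ P (segment 0 n) ≡ filterᵇ P (segment 0 q) ++ q ∷ R ∷ []
filterᵇ-lastTwo P n q R q<R R<n Pq PR between after = begin
    filterᵇ P (segment 0 n)
  ≡⟨ cong (filterᵇ P) (segment-split 0 n q z≤n (<⇒≤ q<n)) ⟩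
    filterᵇ P (segment 0 q ++ segment q (n ∸ q))
  ≡⟨ filterᵇ-++ P (segment 0 q) _ ⟩
    filterᵇ P (segment 0 q) ++ filterᵇ P (segment q (n ∸ q))
  ≡⟨ cong (λ m → filterᵇ P (segment 0 q) ++ filterᵇ P (segment q m)) (m∸n≡suc[m∸1+n] n q q<n) ⟩
    filterᵇ P (segment 0 q) ++ filterᵇ P (q ∷ segment (suc q) (n ∸ suc q))
  ≡⟨ cong (filterᵇ P (segment 0 q) ++_) (filterᵇ-accept P q _ Pq) ⟩
    filterᵇ P (segment 0 q) ++ q ∷ filterᵇ P (segment (suc q) (n ∸ suc q))
  ≡⟨ cong (λ l → filterᵇ P (segment 0 q) ++ q ∷ l)
       (filterᵇ-segment-first P (suc q) (n ∸ suc q) R q<R (subst (R <_) (sym sq+≡n) R<n) between PR) ⟩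
    filterᵇ P (segment 0 q) ++ q ∷ R ∷ filterᵇ P (segment (suc R) (suc q + (n ∸ suc q) ∸ suc R))
  ≡⟨ cong (λ l → filterᵇ P (segment 0 q) ++ q ∷ R ∷ l)
       (filterᵇ-segment-none P (suc R) _ (λ j R<j j< → after j R<j (subst (j <_) (trans (m+[n∸m]≡n (subst (suc R ≤_) (sym sq+≡n) R<n)) sq+≡n) j<))) ⟩
    filterᵇ P (segment 0 q) ++ q ∷ R ∷ []
  ∎
  where
  open ≡-Reasoning
  q<n : q < n
  q<n = <-trans q<R R<n
  sq+≡n : suc q + (n ∸ suc q) ≡ n
  sq+≡n = m+[n∸m]≡n q<n

IsLast : (ℕ → Bool) → ℕ → ℕ → Set
IsLast P r l = P l ≡ true × l < r × (∀ j → l < j → j < r → P j ≡ false)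

lastOccurrence : ∀ (P : ℕ → Bool) a R → a < R → P a ≡ true → Σ ℕ λ q → a ≤ q × IsLast P R q
lastOccurrence P a (suc R) a<sR Pa with P R in PR
... | true = R , ≤-pred a<sR , PR , ≤-refl , λ j R<j j<sR → ⊥-elim (<-irrefl refl (≤-trans j<sR R<j))
... | false with m≤n⇒m<n∨m≡n (≤-pred a<sR)
...   | inj₂ refl = ⊥-elim (true≢false (trans (sym Pa) PR))
...   | inj₁ a<R with lastOccurrence P a R a<R Pa
...     | q , a≤q , Pq , q<R , after = q , a≤q , Pq , m≤n⇒m≤1+n q<R , after′
  where
  after′ : ∀ j → q < j → j < suc R → P j ≡ false
  after′ j q<j j<sR with m≤n⇒m<n∨m≡n (≤-pred j<sR)
  ... | inj₁ j<R = after j q<j j<R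
  ... | inj₂ refl = PR

last-snoc : ∀ (xs : List ℕ) x → last (xs ++ x ∷ []) ≡ just x
last-snoc [] x = refl
last-snoc (y ∷ []) x = refl
last-snoc (y ∷ z ∷ zs) x = last-snoc (z ∷ zs) x

lastOr0-just : ∀ xs x → last xs ≡ just x → lastOr0 xs ≡ x
lastOr0-just xs x e with last xs
lastOr0-just xs x refl | .(just x) = refl

lastOr0-segment-accept : ∀ (P : ℕ → Bool) r → P r ≡ true → lastOr0 (filterᵇ P (segment 0 (suc r))) ≡ r
lastOr0-segment-accept P r Pr = lastOr0-just (filterᵇ P (segment 0 (suc r))) r
  (trans (cong last (trans (filterᵇ-segment-suc P r) (cong (filterᵇ P (segment 0 r) ++_) (filterᵇ-accept P r [] Pr))))
         (last-snoc (filterᵇ P (segment 0 r)) r))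

lastOr0-segment-reject : ∀ (P : ℕ → Bool) r → P r ≡ false →
  lastOr0 (filterᵇ P (segment 0 (suc r))) ≡ lastOr0 (filterᵇ P (segment 0 r))
lastOr0-segment-reject P r Pr = cong lastOr0
  (trans (filterᵇ-segment-suc P r) (trans (cong (filterᵇ P (segment 0 r) ++_) (filterᵇ-reject P r [] Pr)) (++-identityʳ _)))

isLast-lastOr0 : ∀ (P : ℕ → Bool) r m → m < r → P m ≡ true →
  IsLast P r (lastOr0 (filterᵇ P (segment 0 r))) × m ≤ lastOr0 (filterᵇ P (segment 0 r))
isLast-lastOr0 P (suc r) m m<sr Pm with P r in Pr
... | true = subst (λ l → IsLast P (suc r) l × m ≤ l) (sym (lastOr0-segment-accept P r Pr))
     ((Pr , ≤-refl , λ j r<j j<sr → ⊥-elim (<-irrefl refl (≤-trans j<sr r<j))) , ≤-pred m<sr)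
... | false = subst (λ l → IsLast P (suc r) l × m ≤ l) (sym (lastOr0-segment-reject P r Pr))
     ((proj₁ (proj₁ below) , m≤n⇒m≤1+n (proj₁ (proj₂ (proj₁ below))) , after) , proj₂ below)
  where
  m<r : m < r
  m<r with m≤n⇒m<n∨m≡n (≤-pred m<sr)
  ... | inj₁ h = h
  ... | inj₂ refl = ⊥-elim (true≢false (trans (sym Pm) Pr))
  below : IsLast P r (lastOr0 (filterᵇ P (segment 0 r))) × m ≤ lastOr0 (filterᵇ P (segment 0 r))
  below = isLast-lastOr0 P r m m<r Pm
  after : ∀ j → lastOr0 (filterᵇ P (segment 0 r)) < j → j < suc r → P j ≡ false
  after j l<j j<sr with m≤n⇒m<n∨m≡n (≤-pred j<sr)
  ... | inj₁ j<r = proj₂ (proj₂ (proj₁ below)) j l<j j<r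
  ... | inj₂ refl = Pr

map-at-∷-segment : ∀ x xs a k → map (at (x ∷ xs)) (segment (suc a) k) ≡ map (at xs) (segment a k)
map-at-∷-segment x xs a zero = refl
map-at-∷-segment x xs a (suc k) = cong (at xs a ∷_) (map-at-∷-segment x xs (suc a) k)

map-at-segment : ∀ xs a k → a + k ≤ length xs → map (at xs) (segment a k) ≡ take k (drop a xs)
map-at-segment xs a zero h = refl
map-at-segment [] zero (suc k) ()
map-at-segment [] (suc a) (suc k) ()
map-at-segment (x ∷ xs) zero (suc k) (s≤s h) = cong (x ∷_) (trans (map-at-∷-segment x xs 0 k) (map-at-segment xs 0 k h))
map-at-segment (x ∷ xs) (suc a) (suc k) (s≤s h) = trans (map-at-∷-segment x xs a (suc k)) (map-at-segment xs a (suc k) h)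

map-at-suffix : ∀ xs a → a ≤ length xs → map (at xs) (segment a (length xs ∸ a)) ≡ drop a xs
map-at-suffix xs a h = trans (map-at-segment xs a (length xs ∸ a) (≤-reflexive (m+[n∸m]≡n h)))
  (take-all _ (drop a xs) (≤-reflexive (length-drop a xs)))

count-at-range : ∀ (Q : ℕ → Bool) s a → count (λ j → Q (at s j)) (range a (length s)) ≡ count Q (drop a s)
count-at-range Q s a with a ≤? length s
... | yes h = trans (cong (count (λ j → Q (at s j))) (range≡segment a (length s)))
               (trans (sym (count-map Q (at s) (segment a (length s ∸ a)))) (cong (count Q) (map-at-suffix s a h)))
... | no h = trans (cong (count (λ j → Q (at s j))) (range≡segment a (length s)))
               (trans (cong (λ m → count (λ j → Q (at s j)) (segment a m)) (m≤n⇒m∸n≡0 (<⇒≤ (≰⇒> h))))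
                 (cong (count Q) (sym (drop-all a s (<⇒≤ (≰⇒> h))))))

minimumOr0-pos : ∀ s a b → a < b → (∀ j → a ≤ j → j < b → 0 < at s j) → 0 < minimumOr0 (map (at s) (range a b))
minimumOr0-pos s a b a<b pos rewrite range≡segment a b | m∸n≡suc[m∸1+n] b a a<b =
  foldr-⊓-pos (at s a) (map (at s) (segment (suc a) (b ∸ suc a))) (pos a ≤-refl a<b)
    (Allₚ.map⁺ (All-segment (λ j → 0 < at s j) (suc a) (b ∸ suc a) (λ j a<j j< → pos j (<⇒≤ a<j) (subst (j <_) (m+[n∸m]≡n a<b) j<))))

-- Duplicating an entry

dupAt : ℕ → List ℕ → List ℕ
dupAt p [] = []
dupAt zero (x ∷ xs) = x ∷ x ∷ xs
dupAt (suc p) (x ∷ xs) = x ∷ dupAt p xs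

delAt : ℕ → List ℕ → List ℕ
delAt p [] = []
delAt zero (x ∷ xs) = xs
delAt (suc p) (x ∷ xs) = x ∷ delAt p xs

length-dupAt : ∀ p t → p < length t → length (dupAt p t) ≡ suc (length t)
length-dupAt zero (x ∷ t) h = refl
length-dupAt (suc p) (x ∷ t) (s≤s h) = cong suc (length-dupAt p t h)

length-delAt : ∀ p s → p < length s → suc (length (delAt p s)) ≡ length s
length-delAt zero (x ∷ s) h = refl
length-delAt (suc p) (x ∷ s) (s≤s h) = cong suc (length-delAt p s h)

delAt-dupAt : ∀ p t → delAt p (dupAt p t) ≡ t
delAt-dupAt p [] = refl
delAt-dupAt zero (x ∷ t) = refl
delAt-dupAt (suc p) (x ∷ t) = cong (x ∷_) (delAt-dupAt p t)

dupAt-delAt : ∀ p s → suc p < length s → at s p ≡ at s (suc p) → dupAt p (delAt p s) ≡ s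
dupAt-delAt zero (x ∷ y ∷ s) h e = cong (λ z → z ∷ y ∷ s) (sym e)
dupAt-delAt zero (x ∷ []) (s≤s ()) e
dupAt-delAt (suc p) (x ∷ s) (s≤s h) e = cong (x ∷_) (dupAt-delAt p s h e)

at-dupAt-≤ : ∀ p t k → k ≤ p → at (dupAt p t) k ≡ at t k
at-dupAt-≤ p [] k h = refl
at-dupAt-≤ zero (x ∷ t) zero h = refl
at-dupAt-≤ (suc p) (x ∷ t) zero h = refl
at-dupAt-≤ (suc p) (x ∷ t) (suc k) (s≤s h) = at-dupAt-≤ p t k h

at-dupAt-≥ : ∀ p t k → p ≤ k → p < length t → at (dupAt p t) (suc k) ≡ at t k
at-dupAt-≥ zero (x ∷ t) zero h _ = refl
at-dupAt-≥ zero (x ∷ t) (suc k) h _ = refl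
at-dupAt-≥ (suc p) (x ∷ t) (suc k) (s≤s h) (s≤s l) = at-dupAt-≥ p t k h l

take-dupAt-≤ : ∀ p t k → k ≤ p → take k (dupAt p t) ≡ take k t
take-dupAt-≤ p [] k h = refl
take-dupAt-≤ p (x ∷ t) zero h = refl
take-dupAt-≤ (suc p) (x ∷ t) (suc k) (s≤s h) = cong (x ∷_) (take-dupAt-≤ p t k h)

take-dupAt-suc : ∀ p t → take (suc p) (dupAt p t) ≡ take (suc p) t
take-dupAt-suc p [] = refl
take-dupAt-suc zero (x ∷ t) = refl
take-dupAt-suc (suc p) (x ∷ t) = cong (x ∷_) (take-dupAt-suc p t)

take-dupAt-> : ∀ p t k → p < k → take (suc k) (dupAt p t) ≡ dupAt p (take k t)
take-dupAt-> p [] zero h = refl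
take-dupAt-> p [] (suc k) h = refl
take-dupAt-> zero (x ∷ t) (suc k) h = refl
take-dupAt-> (suc p) (x ∷ t) (suc k) (s≤s h) = cong (x ∷_) (take-dupAt-> p t k h)

drop-dupAt-≤ : ∀ p t k → k ≤ p → drop k (dupAt p t) ≡ dupAt (p ∸ k) (drop k t)
drop-dupAt-≤ p [] zero h = refl
drop-dupAt-≤ p [] (suc k) h = refl
drop-dupAt-≤ p (x ∷ t) zero h = refl
drop-dupAt-≤ (suc p) (x ∷ t) (suc k) (s≤s h) = drop-dupAt-≤ p t k h

drop-dupAt-≥ : ∀ p t k → p ≤ k → p < length t → drop (suc k) (dupAt p t) ≡ drop k t
drop-dupAt-≥ zero (x ∷ t) zero h _ = refl
drop-dupAt-≥ zero (x ∷ t) (suc k) h _ = refl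
drop-dupAt-≥ (suc p) (x ∷ t) (suc k) (s≤s h) (s≤s l) = drop-dupAt-≥ p t k h l

count-dupAt : ∀ (q : ℕ → Bool) p t → p < length t → count q (dupAt p t) ≡ χ (q (at t p)) + count q t
count-dupAt q zero (x ∷ t) h = count-∷ q x (x ∷ t)
count-dupAt q (suc p) (x ∷ t) (s≤s h) = begin
    count q (x ∷ dupAt p t)                 ≡⟨ count-∷ q x (dupAt p t) ⟩
    χ (q x) + count q (dupAt p t)           ≡⟨ cong (χ (q x) +_) (count-dupAt q p t h) ⟩
    χ (q x) + (χ (q (at t p)) + count q t)  ≡⟨ sym (+-assoc (χ (q x)) _ _) ⟩
    χ (q x) + χ (q (at t p)) + count q t    ≡⟨ cong (_+ count q t) (+-comm (χ (q x)) _) ⟩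
    χ (q (at t p)) + χ (q x) + count q t    ≡⟨ +-assoc (χ (q (at t p))) _ _ ⟩
    χ (q (at t p)) + (χ (q x) + count q t)  ≡⟨ cong (χ (q (at t p)) +_) (sym (count-∷ q x t)) ⟩
    χ (q (at t p)) + count q (x ∷ t)        ∎
  where open ≡-Reasoning

all-dupAt : ∀ (q : ℕ → Bool) p t → all q (dupAt p t) ≡ all q t
all-dupAt q p [] = refl
all-dupAt q zero (x ∷ t) = trans (sym (∧-assoc (q x) (q x) _)) (cong (_∧ all q t) (∧-idem (q x)))
all-dupAt q (suc p) (x ∷ t) = cong (q x ∧_) (all-dupAt q p t)

any-dupAt : ∀ (q : ℕ → Bool) p t → any q (dupAt p t) ≡ any q t
any-dupAt q p [] = refl
any-dupAt q zero (x ∷ t) = trans (sym (∨-assoc (q x) (q x) _)) (cong (_∨ any q t) (∨-idem (q x)))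
any-dupAt q (suc p) (x ∷ t) = cong (q x ∨_) (any-dupAt q p t)

count-dupAt-indices : ∀ (Qs Qt : ℕ → Bool) p t → p < length t →
  (∀ i → i ≤ p → Qs i ≡ Qt i) → Qs (suc p) ≡ false → (∀ k → p < k → k < length t → Qs (suc k) ≡ Qt k) →
  count Qs (upTo (length (dupAt p t))) ≡ count Qt (upTo (length t))
count-dupAt-indices Qs Qt p t p<n below copy above = begin
    count Qs (upTo (length (dupAt p t)))
  ≡⟨ cong (count Qs) (trans (upTo≡segment _) (cong (segment 0) (length-dupAt p t p<n))) ⟩
    count Qs (segment 0 (suc n))
  ≡⟨ cong (count Qs) (segment-split 0 (suc n) (suc p) z≤n (s≤s (<⇒≤ p<n))) ⟩
    count Qs (segment 0 (suc p) ++ segment (suc p) (n ∸ p))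
  ≡⟨ count-++ Qs (segment 0 (suc p)) _ ⟩
    count Qs (segment 0 (suc p)) + count Qs (segment (suc p) (n ∸ p))
  ≡⟨ cong₂ _+_ (count-cong-segment Qs Qt 0 (suc p) (λ i _ i<sp → below i (≤-pred i<sp)))
               (cong (λ m → count Qs (segment (suc p) m)) (m∸n≡suc[m∸1+n] n p p<n)) ⟩
    count Qt (segment 0 (suc p)) + count Qs (suc p ∷ segment (suc (suc p)) (n ∸ suc p))
  ≡⟨ cong (count Qt (segment 0 (suc p)) +_) (trans (count-∷ Qs (suc p) _) (cong (λ b → χ b + count Qs (segment (suc (suc p)) (n ∸ suc p))) copy)) ⟩
    count Qt (segment 0 (suc p)) + count Qs (segment (suc (suc p)) (n ∸ suc p))
  ≡⟨ cong (λ l → count Qt (segment 0 (suc p)) + count Qs l) (sym (map-suc-segment (suc p) (n ∸ suc p))) ⟩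
    count Qt (segment 0 (suc p)) + count Qs (map suc (segment (suc p) (n ∸ suc p)))
  ≡⟨ cong (count Qt (segment 0 (suc p)) +_) (trans (count-map Qs suc (segment (suc p) (n ∸ suc p)))
       (count-cong-segment (Qs ∘ suc) Qt (suc p) (n ∸ suc p) (λ k p<k k< → above k p<k (subst (k <_) (m+[n∸m]≡n p<n) k<)))) ⟩
    count Qt (segment 0 (suc p)) + count Qt (segment (suc p) (n ∸ suc p))
  ≡⟨ sym (count-++ Qt (segment 0 (suc p)) _) ⟩
    count Qt (segment 0 (suc p) ++ segment (suc p) (n ∸ suc p))
  ≡⟨ cong (count Qt) (sym (trans (upTo≡segment n) (segment-split 0 n (suc p) z≤n p<n))) ⟩
    count Qt (upTo n)
  ∎
  where
  open ≡-Reasoning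
  n : ℕ
  n = length t

-- Ascent sequences

headAscent : ℕ → List ℕ → ℕ
headAscent x [] = 0
headAscent x (y ∷ _) = χ (x <ᵇ y)

asc-∷ : ∀ x u → asc (x ∷ u) ≡ headAscent x u + asc u
asc-∷ x [] = refl
asc-∷ x (y ∷ r) =
  begin
    asc (x ∷ y ∷ r)
  ≡⟨ cong (count P) (upTo≡segment (suc (length r))) ⟩
    count P (segment 0 (suc (length r)))
  ≡⟨ count-∷ P 0 (segment 1 (length r)) ⟩
    χ (x <ᵇ y) + count P (segment 1 (length r))
  ≡⟨ cong (λ z → χ (x <ᵇ y) + count P z) (sym (map-suc-segment 0 (length r))) ⟩
    χ (x <ᵇ y) + count P (map suc (segment 0 (length r)))
  ≡⟨ cong (χ (x <ᵇ y) +_) (count-map P suc (segment 0 (length r))) ⟩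
    χ (x <ᵇ y) + count (λ i → at (y ∷ r) i <ᵇ at (y ∷ r) (suc i)) (segment 0 (length r))
  ≡⟨ cong (λ z → χ (x <ᵇ y) + count (λ i → at (y ∷ r) i <ᵇ at (y ∷ r) (suc i)) z) (sym (upTo≡segment (length r))) ⟩
    χ (x <ᵇ y) + asc (y ∷ r)
  ∎
  where
  open ≡-Reasoning
  P : ℕ → Bool
  P i = at (x ∷ y ∷ r) i <ᵇ at (x ∷ y ∷ r) (suc i)

headAscent-dupAt : ∀ x p u → p < length u → headAscent x (dupAt p u) ≡ headAscent x u
headAscent-dupAt x zero (y ∷ u) h = refl
headAscent-dupAt x (suc p) (y ∷ u) h = refl

asc-dupAt : ∀ p t → p < length t → asc (dupAt p t) ≡ asc t
asc-dupAt zero (x ∷ u) h =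
  trans (asc-∷ x (x ∷ u)) (cong (λ b → χ b + asc (x ∷ u)) (<ᵇ-irrefl x))
asc-dupAt (suc p) (x ∷ u) (s≤s h) =
  trans (asc-∷ x (dupAt p u)) (trans (cong₂ _+_ (headAscent-dupAt x p u h) (asc-dupAt p u h)) (sym (asc-∷ x u)))

asc≤length∸1 : ∀ u → asc u ≤ length u ∸ 1
asc≤length∸1 u = subst (asc u ≤_) (length-upTo (length u ∸ 1)) (count≤length _ (upTo (length u ∸ 1)))

headAscent-take : ∀ x j u → headAscent x (take j u) ≤ headAscent x u
headAscent-take x zero u = z≤n
headAscent-take x (suc j) [] = z≤n
headAscent-take x (suc j) (y ∷ u) = ≤-refl

asc-take≤asc : ∀ j u → asc (take j u) ≤ asc u
asc-take≤asc zero u = z≤n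
asc-take≤asc (suc j) [] = z≤n
asc-take≤asc (suc j) (x ∷ u) =
  subst₂ _≤_ (sym (asc-∷ x (take j u))) (sym (asc-∷ x u)) (+-mono-≤ (headAscent-take x j u) (asc-take≤asc j u))

asc-take≤asc-take-suc : ∀ j u → asc (take j u) ≤ asc (take (suc j) u)
asc-take≤asc-take-suc j u = subst (_≤ asc (take (suc j) u))
  (cong asc (trans (take-take j (suc j) u) (cong (λ z → take z u) (m≤n⇒m⊓n≡m (n≤1+n j)))))
  (asc-take≤asc j (take (suc j) u))

AscentBounds : List ℕ → Set
AscentBounds s = ∀ i → 1 ≤ i → i < length s → at s i ≤ asc (take i s) + 1

IsAscent : List ℕ → Set
IsAscent s = at s 0 ≡ 0 × AscentBounds s

ascentBoundᵇ : List ℕ → ℕ → Bool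
ascentBoundᵇ s i = at s i ≤ᵇ asc (take i s) + 1

isAscent-∷ : ∀ x xs → isAscent (x ∷ xs) ≡ (x ≡ᵇ 0) ∧ all (ascentBoundᵇ (x ∷ xs)) (segment 1 (length xs))
isAscent-∷ x xs = cong (λ z → (x ≡ᵇ 0) ∧ all (ascentBoundᵇ (x ∷ xs)) z) (range≡segment 1 (suc (length xs)))

isAscent-sound : ∀ s → isAscent s ≡ true → IsAscent s
isAscent-sound [] e = refl , λ i _ ()
isAscent-sound (x ∷ xs) e =
  let e' = trans (sym (isAscent-∷ x xs)) e in
  ≡ᵇ≡true⇒≡ x 0 (∧≡true⇒ˡ e') ,
  λ i 1≤i i< → ≤ᵇ≡true⇒≤ _ _ (all-segment-elim (ascentBoundᵇ (x ∷ xs)) 1 (length xs) (∧≡true⇒ʳ {x ≡ᵇ 0} e') i 1≤i i<)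

isAscent-complete : ∀ s → IsAscent s → isAscent s ≡ true
isAscent-complete [] _ = refl
isAscent-complete (x ∷ xs) (h , a) = trans (isAscent-∷ x xs)
  (∧≡true (≡⇒≡ᵇ≡true h) (all-segment-intro (ascentBoundᵇ (x ∷ xs)) 1 (length xs) (λ i 1≤i i< → ≤⇒≤ᵇ≡true (a i 1≤i i<))))

at≤index : ∀ s → IsAscent s → ∀ i → at s i ≤ i
at≤index s (h0 , a) zero = ≤-reflexive h0
at≤index s (h0 , a) (suc i) with suc i <? length s
... | yes lt = ≤-trans (a (suc i) (s≤s z≤n) lt)
        (subst (_≤ suc i) (+-comm 1 _) (s≤s (≤-trans (asc≤length∸1 (take (suc i) s))
          (≤-reflexive (cong (_∸ 1) (length-take-≤ (suc i) s (<⇒≤ lt)))))))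
... | no nlt = ≤-trans (≤-reflexive (at-out s (suc i) (≮⇒≥ nlt))) z≤n
  where
  at-out : ∀ s i → length s ≤ i → at s i ≡ 0
  at-out [] i h = refl
  at-out (x ∷ s) (suc i) (s≤s h) = at-out s i h

ascentBound-take-suc : ∀ p t → p < length t → IsAscent t → at t p ≤ asc (take (suc p) t) + 1
ascentBound-take-suc zero t pl (h0 , a) = ≤-trans (≤-reflexive h0) z≤n
ascentBound-take-suc (suc q) t pl (h0 , a) =
  ≤-trans (a (suc q) (s≤s z≤n) pl) (+-monoˡ-≤ 1 (asc-take≤asc-take-suc (suc q) t))

ascentBounds-dupAt : ∀ p t → p < length t → IsAscent t → AscentBounds (dupAt p t)
ascentBounds-dupAt p t pl (h0 , a) i 1≤i i< with i ≤? p
... | yes i≤p =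
  subst₂ _≤_ (sym (at-dupAt-≤ p t i i≤p)) (cong (λ z → asc z + 1) (sym (take-dupAt-≤ p t i i≤p)))
    (a i 1≤i (<-≤-trans (s≤s i≤p) pl))
ascentBounds-dupAt p t pl (h0 , a) (suc k) 1≤i i< | no i≰p with m≤n⇒m<n∨m≡n (≤-pred (≰⇒> i≰p))
... | inj₂ refl =
  subst₂ _≤_ (sym (at-dupAt-≥ p t p ≤-refl pl)) (cong (λ z → asc z + 1) (sym (take-dupAt-suc p t)))
    (ascentBound-take-suc p t pl (h0 , a))
... | inj₁ p<k =
  subst₂ _≤_ (sym (at-dupAt-≥ p t k (<⇒≤ p<k) pl))
    (cong (λ z → z + 1) (sym (trans (cong asc (take-dupAt-> p t k p<k)) (asc-dupAt p (take k t) (subst (p <_) (sym (length-take-≤ k t (<⇒≤ k<n))) p<k)))))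
    (a k (≤-trans (s≤s z≤n) p<k) k<n)
  where
  k<n : k < length t
  k<n = ≤-pred (subst (suc k <_) (length-dupAt p t pl) i<)

ascentBounds-dupAt⁻¹ : ∀ p t → p < length t → AscentBounds (dupAt p t) → AscentBounds t
ascentBounds-dupAt⁻¹ p t pl a i 1≤i i< with i ≤? p
... | yes i≤p =
  subst₂ _≤_ (at-dupAt-≤ p t i i≤p) (cong (λ z → asc z + 1) (take-dupAt-≤ p t i i≤p))
    (a i 1≤i (subst (i <_) (sym (length-dupAt p t pl)) (m≤n⇒m≤1+n i<)))
... | no i≰p =
  subst₂ _≤_ (at-dupAt-≥ p t i (<⇒≤ (≰⇒> i≰p)) pl)
    (cong (λ z → z + 1) (trans (cong asc (take-dupAt-> p t i (≰⇒> i≰p))) (asc-dupAt p (take i t) (subst (p <_) (sym (length-take-≤ i t (<⇒≤ i<))) (≰⇒> i≰p)))))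
    (a (suc i) (s≤s z≤n) (subst (suc i <_) (sym (length-dupAt p t pl)) (s≤s i<)))

isAscent-dupAt : ∀ p t → p < length t → isAscent (dupAt p t) ≡ isAscent t
isAscent-dupAt p t pl = ≡true-⇔⇒≡
  (λ e → let (h0 , a) = isAscent-sound (dupAt p t) e in
         isAscent-complete t (trans (sym (at-dupAt-≤ p t 0 z≤n)) h0 , ascentBounds-dupAt⁻¹ p t pl a))
  (λ e → let hA = isAscent-sound t e in
         isAscent-complete (dupAt p t) (trans (at-dupAt-≤ p t 0 z≤n) (proj₁ hA) , ascentBounds-dupAt p t pl hA))

increasing⇒identity : ∀ t → IsAscent t → ∀ K → (∀ l → suc l < K → at t l < at t (suc l)) → ∀ l → l < K → at t l ≡ l
increasing⇒identity t hA K asc zero _ = proj₁ hA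
increasing⇒identity t hA K asc (suc l) sl<K =
  ≤-antisym (at≤index t hA (suc l)) (subst (_< at t (suc l)) (increasing⇒identity t hA K asc l (<-trans (n<1+n l) sl<K)) (asc l sl<K))

fixedPoint⇒prefix-identity : ∀ t → IsAscent t → ∀ k → k < length t → at t k ≡ k → ∀ l → l ≤ k → at t l ≡ l
fixedPoint⇒prefix-identity t hA zero _ _ zero _ = proj₁ hA
fixedPoint⇒prefix-identity t hA (suc k) sk<n tsk≡sk l l≤sk = increasing⇒identity t hA (suc (suc k)) ascending l (s≤s l≤sk)
  where
  prefix : List ℕ
  prefix = take (suc k) t
  all-ascents : k ≤ count (λ i → at prefix i <ᵇ at prefix (suc i)) (segment 0 k)
  all-ascents = subst (λ z → k ≤ count (λ i → at prefix i <ᵇ at prefix (suc i)) z)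
    (trans (cong upTo (cong (_∸ 1) (length-take-≤ (suc k) t (<⇒≤ sk<n)))) (upTo≡segment k))
    (≤-pred (subst (suc k ≤_) (+-comm (asc prefix) 1) (subst (_≤ asc prefix + 1) tsk≡sk (proj₂ hA (suc k) (s≤s z≤n) sk<n))))
  ascending : ∀ l → suc l < suc (suc k) → at t l < at t (suc l)
  ascending l sl<ssk with m≤n⇒m<n∨m≡n (≤-pred sl<ssk)
  ... | inj₁ sl<sk = subst₂ _<_ (at-take t (suc k) l (<-trans (n<1+n l) sl<sk)) (at-take t (suc k) (suc l) sl<sk)
                   (<ᵇ≡true⇒< _ _ (count-segment-full _ 0 k all-ascents l z≤n (≤-pred sl<sk)))
  ... | inj₂ refl = subst (at t l <_) (sym tsk≡sk) (s≤s (at≤index t hA l))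

-- Right-to-left minima

isRLMin : List ℕ → ℕ → Bool
isRLMin s i = all (λ j → at s i <ᵇ at s j) (range (suc i) (length s))

isRLMin≡all-segment : ∀ t k → isRLMin t k ≡ all (λ j → at t k <ᵇ at t j) (segment (suc k) (length t ∸ suc k))
isRLMin≡all-segment t k = cong (all (λ j → at t k <ᵇ at t j)) (range≡segment (suc k) (length t))

isRLMin-sound : ∀ t k → isRLMin t k ≡ true → ∀ j → k < j → j < length t → at t k < at t j
isRLMin-sound t k e j kj jn = <ᵇ≡true⇒< _ _ (all-segment-elim _ (suc k) (length t ∸ suc k) (trans (sym (isRLMin≡all-segment t k)) e) j kj
  (subst (j <_) (sym (m+[n∸m]≡n (≤-trans kj (<⇒≤ jn)))) jn))

isRLMin-complete : ∀ t k → (∀ j → k < j → j < length t → at t k < at t j) → isRLMin t k ≡ true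
isRLMin-complete t k h with suc k ≤? length t
... | yes sk = trans (isRLMin≡all-segment t k) (all-segment-intro _ (suc k) (length t ∸ suc k) (λ j kj jn → <⇒<ᵇ≡true (h j kj (subst (j <_) (m+[n∸m]≡n sk) jn))))
... | no sk = trans (isRLMin≡all-segment t k) (cong (λ m → all (λ j → at t k <ᵇ at t j) (segment (suc k) m)) (m≤n⇒m∸n≡0 (<⇒≤ (≰⇒> sk))))

isRLMin≡all-drop : ∀ s k → isRLMin s k ≡ all (at s k <ᵇ_) (drop (suc k) s)
isRLMin≡all-drop s k with suc k ≤? length s
... | yes h = trans (cong (all (λ j → at s k <ᵇ at s j)) (range≡segment (suc k) (length s)))
               (trans (sym (all-map (at s k <ᵇ_) (at s) (segment (suc k) (length s ∸ suc k))))
                 (cong (all (at s k <ᵇ_)) (map-at-suffix s (suc k) h)))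
... | no h = trans (cong (all (λ j → at s k <ᵇ at s j)) (range≡segment (suc k) (length s)))
               (trans (cong (λ m → all (λ j → at s k <ᵇ at s j) (segment (suc k) m)) (m≤n⇒m∸n≡0 (<⇒≤ (≰⇒> h))))
                 (cong (all (at s k <ᵇ_)) (sym (drop-all (suc k) s (<⇒≤ (≰⇒> h))))))

isRLMin-dupAt-< : ∀ p t k → k < p → p < length t → isRLMin (dupAt p t) k ≡ isRLMin t k
isRLMin-dupAt-< p t k k<p pl =
  trans (isRLMin≡all-drop (dupAt p t) k)
  (trans (cong₂ (λ a l → all (a <ᵇ_) l) (at-dupAt-≤ p t k (<⇒≤ k<p)) (drop-dupAt-≤ p t (suc k) k<p))
  (trans (all-dupAt (at t k <ᵇ_) (p ∸ suc k) (drop (suc k) t))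
  (sym (isRLMin≡all-drop t k))))

isRLMin-dupAt-self : ∀ p t → p < length t → isRLMin (dupAt p t) p ≡ false
isRLMin-dupAt-self p t pl =
  trans (isRLMin≡all-drop (dupAt p t) p)
  (trans (cong₂ (λ a l → all (a <ᵇ_) l) (at-dupAt-≤ p t p ≤-refl) (trans (drop-dupAt-≥ p t p ≤-refl pl) (drop≡at∷drop t p pl)))
  (cong (_∧ all (at t p <ᵇ_) (drop (suc p) t)) (<ᵇ-irrefl (at t p))))

isRLMin-dupAt-≥ : ∀ p t k → p ≤ k → p < length t → isRLMin (dupAt p t) (suc k) ≡ isRLMin t k
isRLMin-dupAt-≥ p t k p≤k pl =
  trans (isRLMin≡all-drop (dupAt p t) (suc k))
  (trans (cong₂ (λ a l → all (a <ᵇ_) l) (at-dupAt-≥ p t k p≤k pl) (drop-dupAt-≥ p t (suc k) (m≤n⇒m≤1+n p≤k) pl))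
  (sym (isRLMin≡all-drop t k)))

rlminPos≡filterᵇ : ∀ s → rlminPos s ≡ filterᵇ (isRLMin s) (segment 0 (length s))
rlminPos≡filterᵇ s = cong (filterᵇ (isRLMin s)) (upTo≡segment (length s))

rlminPos-increasing : ∀ s → StrictlyIncreasing (rlminPos s)
rlminPos-increasing s = subst StrictlyIncreasing (sym (rlminPos≡filterᵇ s)) (filterᵇ-segment-increasing (isRLMin s) 0 (length s))

rlminPos-at : ∀ t i → i < length (rlminPos t) → at (rlminPos t) i < length t × isRLMin t (at (rlminPos t) i) ≡ true
rlminPos-at t i h with All-at (rlminPos t) i (subst (All (SelectedIn (isRLMin t) 0 (length t))) (sym (rlminPos≡filterᵇ t)) (filterᵇ-segment-All (isRLMin t) 0 (length t))) h
... | _ , p<n , isRLMin-p = p<n , isRLMin-p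

rmin≡length-rlminPos : ∀ s → rmin s ≡ length (rlminPos s)
rmin≡length-rlminPos s = length-map (at s) (rlminPos s)

at-Rmin : ∀ t j → j < rmin t → at (Rmin t) j ≡ at t (at (rlminPos t) j)
at-Rmin t j h = at-map (at t) (rlminPos t) j (subst (j <_) (rmin≡length-rlminPos t) h)

rlminPosBefore : List ℕ → ℕ → List ℕ
rlminPosBefore t p = filterᵇ (isRLMin t) (segment 0 p)

rlminPosFrom : List ℕ → ℕ → List ℕ
rlminPosFrom t p = filterᵇ (isRLMin t) (segment p (length t ∸ p))

rlminPosAfter : List ℕ → ℕ → List ℕ
rlminPosAfter t p = filterᵇ (isRLMin t) (segment (suc p) (length t ∸ suc p))

rlminPos-split : ∀ t p → p < length t → rlminPos t ≡ rlminPosBefore t p ++ rlminPosFrom t p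
rlminPos-split t p pl = trans (rlminPos≡filterᵇ t)
  (trans (cong (filterᵇ (isRLMin t)) (segment-split 0 (length t) p z≤n (<⇒≤ pl)))
  (filterᵇ-++ (isRLMin t) (segment 0 p) (segment p (length t ∸ p))))

rlminPosFrom-∷ : ∀ t p → p < length t → isRLMin t p ≡ true → rlminPosFrom t p ≡ p ∷ rlminPosAfter t p
rlminPosFrom-∷ t p pl e = trans (cong (λ m → filterᵇ (isRLMin t) (segment p m)) (m∸n≡suc[m∸1+n] (length t) p pl))
  (filterᵇ-accept (isRLMin t) p _ e)

rlminPos-dupAt : ∀ t p → p < length t → rlminPos (dupAt p t) ≡ rlminPosBefore t p ++ map suc (rlminPosFrom t p)
rlminPos-dupAt t p pl =
  begin
    rlminPos s
  ≡⟨ rlminPos≡filterᵇ s ⟩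
    filterᵇ (isRLMin s) (segment 0 (length s))
  ≡⟨ cong (λ m → filterᵇ (isRLMin s) (segment 0 m)) (length-dupAt p t pl) ⟩
    filterᵇ (isRLMin s) (segment 0 (suc n))
  ≡⟨ cong (filterᵇ (isRLMin s)) (segment-split 0 (suc n) p z≤n (m≤n⇒m≤1+n (<⇒≤ pl))) ⟩
    filterᵇ (isRLMin s) (segment 0 p ++ segment p (suc n ∸ p))
  ≡⟨ filterᵇ-++ (isRLMin s) (segment 0 p) (segment p (suc n ∸ p)) ⟩
    filterᵇ (isRLMin s) (segment 0 p) ++ filterᵇ (isRLMin s) (segment p (suc n ∸ p))
  ≡⟨ cong₂ _++_ (filterᵇ-cong-segment (isRLMin s) (isRLMin t) 0 p (λ i _ i<p → isRLMin-dupAt-< p t i i<p pl))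
                (cong (λ m → filterᵇ (isRLMin s) (segment p m)) (+-∸-assoc 1 (<⇒≤ pl))) ⟩
    rlminPosBefore t p ++ filterᵇ (isRLMin s) (p ∷ segment (suc p) (n ∸ p))
  ≡⟨ cong (rlminPosBefore t p ++_) (filterᵇ-reject (isRLMin s) p _ (isRLMin-dupAt-self p t pl)) ⟩
    rlminPosBefore t p ++ filterᵇ (isRLMin s) (segment (suc p) (n ∸ p))
  ≡⟨ cong (λ l → rlminPosBefore t p ++ filterᵇ (isRLMin s) l) (sym (map-suc-segment p (n ∸ p))) ⟩
    rlminPosBefore t p ++ filterᵇ (isRLMin s) (map suc (segment p (n ∸ p)))
  ≡⟨ cong (rlminPosBefore t p ++_) (filterᵇ-map (isRLMin s) suc (segment p (n ∸ p))) ⟩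
    rlminPosBefore t p ++ map suc (filterᵇ (λ k → isRLMin s (suc k)) (segment p (n ∸ p)))
  ≡⟨ cong (λ l → rlminPosBefore t p ++ map suc l) (filterᵇ-cong-segment (λ k → isRLMin s (suc k)) (isRLMin t) p (n ∸ p) (λ k p≤k _ → isRLMin-dupAt-≥ p t k p≤k pl)) ⟩
    rlminPosBefore t p ++ map suc (rlminPosFrom t p)
  ∎
  where
  open ≡-Reasoning
  s : List ℕ
  s = dupAt p t
  n : ℕ
  n = length t

rlminPosBefore-All : ∀ t p → All (λ x → x < p × isRLMin t x ≡ true) (rlminPosBefore t p)
rlminPosBefore-All t p = All.map (λ {x} h → proj₁ (proj₂ h) , proj₂ (proj₂ h)) (filterᵇ-segment-All (isRLMin t) 0 p)

rlminPosFrom-All : ∀ t p → p < length t → All (λ x → p ≤ x × x < length t × isRLMin t x ≡ true) (rlminPosFrom t p)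
rlminPosFrom-All t p pl = All.map (λ {x} h → proj₁ h , subst (x <_) (m+[n∸m]≡n (<⇒≤ pl)) (proj₁ (proj₂ h)) , proj₂ (proj₂ h)) (filterᵇ-segment-All (isRLMin t) p (length t ∸ p))

rlminPosAfter-All : ∀ t p → p < length t → All (λ x → p < x × x < length t × isRLMin t x ≡ true) (rlminPosAfter t p)
rlminPosAfter-All t p pl = All.map (λ {x} h → proj₁ h , subst (x <_) (m+[n∸m]≡n pl) (proj₁ (proj₂ h)) , proj₂ (proj₂ h)) (filterᵇ-segment-All (isRLMin t) (suc p) (length t ∸ suc p))

Rmin-dupAt : ∀ t p → p < length t → Rmin (dupAt p t) ≡ Rmin t
Rmin-dupAt t p pl =
  begin
    map (at s) (rlminPos s)
  ≡⟨ cong (map (at s)) (rlminPos-dupAt t p pl) ⟩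
    map (at s) (rlminPosBefore t p ++ map suc (rlminPosFrom t p))
  ≡⟨ map-++ (at s) (rlminPosBefore t p) (map suc (rlminPosFrom t p)) ⟩
    map (at s) (rlminPosBefore t p) ++ map (at s) (map suc (rlminPosFrom t p))
  ≡⟨ cong₂ _++_ (map-cong-local (All.map (λ {x} h → at-dupAt-≤ p t x (<⇒≤ (proj₁ h))) (rlminPosBefore-All t p)))
                (trans (sym (map-∘ (rlminPosFrom t p)))
                       (map-cong-local (All.map (λ {x} h → at-dupAt-≥ p t x (proj₁ h) pl) (rlminPosFrom-All t p pl)))) ⟩
    map (at t) (rlminPosBefore t p) ++ map (at t) (rlminPosFrom t p)
  ≡⟨ sym (map-++ (at t) (rlminPosBefore t p) (rlminPosFrom t p)) ⟩
    map (at t) (rlminPosBefore t p ++ rlminPosFrom t p)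
  ≡⟨ cong (map (at t)) (sym (rlminPos-split t p pl)) ⟩
    map (at t) (rlminPos t)
  ∎
  where
  open ≡-Reasoning
  s : List ℕ
  s = dupAt p t

rmin-dupAt : ∀ t p → p < length t → rmin (dupAt p t) ≡ rmin t
rmin-dupAt t p pl = cong length (Rmin-dupAt t p pl)

rmin≤length : ∀ s → rmin s ≤ length s
rmin≤length s = subst₂ _≤_ (sym (trans (rmin≡length-rlminPos s) (cong length (rlminPos≡filterᵇ s)))) (length-segment 0 (length s)) (count≤length (isRLMin s) (segment 0 (length s)))

rmin-dupAt≢length : ∀ t p → p < length t → ¬ (rmin (dupAt p t) ≡ length (dupAt p t))
rmin-dupAt≢length t p pl h = <-irrefl refl (≤-trans (s≤s (rmin≤length t)) (≤-reflexive (trans (sym (length-dupAt p t pl)) (trans (sym h) (rmin-dupAt t p pl)))))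

rmin>0 : ∀ t → 0 < length t → 0 < rmin t
rmin>0 (x ∷ xs) _ = subst (0 <_) (sym (trans (rmin≡length-rlminPos (x ∷ xs)) (cong length (rlminPos≡filterᵇ (x ∷ xs)))))
  (witness⇒count-segment-pos (isRLMin (x ∷ xs)) 0 (suc (length xs)) (length xs) z≤n ≤-refl
    (isRLMin-complete (x ∷ xs) (length xs) (λ j lj jn → ⊥-elim (<-irrefl refl (≤-trans jn lj)))))

all-isRLMin⇒rmin≡length : ∀ t → (∀ i → 0 ≤ i → i < length t → isRLMin t i ≡ true) → rmin t ≡ length t
all-isRLMin⇒rmin≡length t all-rl = trans (rmin≡length-rlminPos t)
  (trans (cong length (trans (rlminPos≡filterᵇ t) (filterᵇ-segment-all (isRLMin t) 0 (length t) all-rl))) (length-segment 0 (length t)))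

isIdentity⇒rmin≡length : ∀ t → isIdentity t ≡ true → rmin t ≡ length t
isIdentity⇒rmin≡length t id-t = all-isRLMin⇒rmin≡length t λ i _ i<n →
  isRLMin-complete t i λ j i<j j<n → subst₂ _<_ (sym (identity i i<n)) (sym (identity j j<n)) i<j
  where
  identity : ∀ i → i < length t → at t i ≡ i
  identity i i<n = ≡ᵇ≡true⇒≡ _ _ (all-segment-elim _ 0 (length t) (trans (cong (all (λ i → at t i ≡ᵇ i)) (sym (upTo≡segment (length t)))) id-t) i z≤n i<n)

rmin≡length⇒isIdentity : ∀ t → IsAscent t → rmin t ≡ length t → isIdentity t ≡ true
rmin≡length⇒isIdentity t hA e = trans (cong (all (λ i → at t i ≡ᵇ i)) (upTo≡segment (length t)))
  (all-segment-intro _ 0 (length t) (λ i _ h → ≡⇒≡ᵇ≡true (increasing⇒identity t hA (length t) steps i h)))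
  where
  allRL : ∀ i → 0 ≤ i → i < length t → isRLMin t i ≡ true
  allRL = count-segment-full (isRLMin t) 0 (length t) (≤-reflexive (trans (sym e) (trans (rmin≡length-rlminPos t) (cong length (rlminPos≡filterᵇ t)))))
  steps : ∀ l → suc l < length t → at t l < at t (suc l)
  steps l h = isRLMin-sound t l (allRL l z≤n (<-trans (n<1+n l) h)) (suc l) ≤-refl h

Rmin-head≡0 : ∀ t → IsAscent t → 0 < length t → at (Rmin t) 0 ≡ 0
Rmin-head≡0 t (h0 , _) 0<n with lastOccurrence (λ x → at t x ≡ᵇ 0) 0 (length t) 0<n (≡⇒≡ᵇ≡true h0)
... | z , _ , tz≡ᵇ0 , z<n , after =
  trans (at-map (at t) (rlminPos t) 0 (subst (λ l → 0 < length l) (sym rlminPos≡) (s≤s z≤n)))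
        (trans (cong (λ l → at t (at l 0)) rlminPos≡) tz≡0)
  where
  tz≡0 : at t z ≡ 0
  tz≡0 = ≡ᵇ≡true⇒≡ _ _ tz≡ᵇ0
  before : ∀ l → 0 ≤ l → l < z → isRLMin t l ≡ false
  before l _ l<z with isRLMin t l in rl
  ... | false = refl
  ... | true = ⊥-elim (<⇒≱ (isRLMin-sound t l rl z l<z z<n) (subst (_≤ at t l) (sym tz≡0) z≤n))
  isRLMin-z : isRLMin t z ≡ true
  isRLMin-z = isRLMin-complete t z λ j z<j j<n →
    subst (_< at t j) (sym tz≡0) (n≢0⇒n>0 (≡ᵇ≡false⇒≢ _ _ (after j z<j j<n)))
  rlminPos≡ : rlminPos t ≡ z ∷ filterᵇ (isRLMin t) (segment (suc z) (length t ∸ suc z))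
  rlminPos≡ = trans (rlminPos≡filterᵇ t) (filterᵇ-segment-first (isRLMin t) 0 (length t) z z≤n z<n before isRLMin-z)

-- The index rpos

-- rposOK s m counts Rmin(s)_m in the suffix of s starting at windowStart s m, i.e. after
-- the (m−1)-th right-to-left minimum (all of s when m = 0).
windowStart : List ℕ → ℕ → ℕ
windowStart s zero = 0
windowStart s (suc m) = suc (at (rlminPos s) m)

rposWindow : List ℕ → ℕ → List ℕ
rposWindow s m = drop (windowStart s m) s

rposOK≡ : ∀ s m → rposOK s m ≡ (2 ≤ᵇ count (_≡ᵇ at (Rmin s) m) (rposWindow s m))
rposOK≡ s zero = refl
rposOK≡ s (suc m) = cong (2 ≤ᵇ_) (count-at-range (_≡ᵇ at (Rmin s) (suc m)) s (suc (at (rlminPos s) m)))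

rpos≡lastOr0 : ∀ s → ¬ (rmin s ≡ length s) → rpos s ≡ lastOr0 (filterᵇ (rposOK s) (segment 0 (rmin s)))
rpos≡lastOr0 s h with rmin s ≡ᵇ length s in eq
... | true = ⊥-elim (h (≡ᵇ≡true⇒≡ _ _ eq))
... | false = cong lastOr0 (cong (filterᵇ (rposOK s)) (upTo≡segment (rmin s)))

rpos-isLast : ∀ s → ¬ (rmin s ≡ length s) → ∀ m → m < rmin s → rposOK s m ≡ true → IsLast (rposOK s) (rmin s) (rpos s) × m ≤ rpos s
rpos-isLast s h m mr pm = subst (λ l → IsLast (rposOK s) (rmin s) l × m ≤ l) (sym (rpos≡lastOr0 s h)) (isLast-lastOr0 (rposOK s) (rmin s) m mr pm)

IdentityPrefix : List ℕ → ℕ → Set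
IdentityPrefix t k = (∀ l → l ≤ k → at t l ≡ l) × (∀ l → l ≤ k → isRLMin t l ≡ true)

module AfterIdentityPrefix (t : List ℕ) (hA : IsAscent t) (k : ℕ) (pre : IdentityPrefix t k) (sk<n : suc k < length t) where
  n : ℕ
  n = length t

  k<at : ∀ j → k < j → j < n → k < at t j
  k<at j k<j j<n = subst (_< at t j) (proj₁ pre k ≤-refl) (isRLMin-sound t k (proj₂ pre k ≤-refl) j k<j j<n)

  at-suc-k : at t (suc k) ≡ suc k
  at-suc-k = ≤-antisym (at≤index t hA (suc k)) (k<at (suc k) ≤-refl sk<n)

  extend : isRLMin t (suc k) ≡ true → IdentityPrefix t (suc k)
  extend rl = extended (proj₁ pre) at-suc-k , extended (proj₂ pre) rl
    where
    extended : ∀ {P : ℕ → Set} → (∀ l → l ≤ k → P l) → P (suc k) → ∀ l → l ≤ suc k → P l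
    extended below top l l≤sk with m≤n⇒m<n∨m≡n l≤sk
    ... | inj₁ l<sk = below l (≤-pred l<sk)
    ... | inj₂ refl = top

  rlminPos≡ : rlminPos t ≡ segment 0 (suc k) ++ filterᵇ (isRLMin t) (segment (suc k) (n ∸ suc k))
  rlminPos≡ = trans (rlminPos≡filterᵇ t) (trans (cong (filterᵇ (isRLMin t)) (segment-split 0 n (suc k) z≤n (<⇒≤ sk<n)))
    (trans (filterᵇ-++ (isRLMin t) (segment 0 (suc k)) (segment (suc k) (n ∸ suc k)))
      (cong (_++ filterᵇ (isRLMin t) (segment (suc k) (n ∸ suc k))) (filterᵇ-segment-all (isRLMin t) 0 (suc k) (λ i _ i<sk → proj₂ pre i (≤-pred i<sk))))))

  repeat : isRLMin t (suc k) ≡ false → Σ ℕ λ j → suc k < j × j < n × at t j ≡ suc k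
  repeat rl with all-segment-false-witness _ (suc (suc k)) (n ∸ suc (suc k)) (trans (sym (isRLMin≡all-segment t (suc k))) rl)
  ... | j , sk<j , j<ssk+ , tsk≮tj =
    j , sk<j , j<n , ≤-antisym (subst (at t j ≤_) at-suc-k (<ᵇ≡false⇒≥ _ _ tsk≮tj)) (k<at j (<-trans (n<1+n k) sk<j) j<n)
    where
    j<n : j < n
    j<n = subst (j <_) (m+[n∸m]≡n sk<n) j<ssk+

  lastRepeat : isRLMin t (suc k) ≡ false → Σ ℕ λ r → suc k < r × IsLast (λ x → at t x ≡ᵇ suc k) n r
  lastRepeat rl with repeat rl
  ... | j , sk<j , j<n , tj≡sk with lastOccurrence (λ x → at t x ≡ᵇ suc k) j n j<n (≡⇒≡ᵇ≡true tj≡sk)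
  ...   | r , j≤r , last = r , <-≤-trans sk<j j≤r , last

  module Repeated (r : ℕ) (sk<r : suc k < r) (last : IsLast (λ x → at t x ≡ᵇ suc k) n r) where
    at-r : at t r ≡ suc k
    at-r = ≡ᵇ≡true⇒≡ _ _ (proj₁ last)

    r<n : r < n
    r<n = proj₁ (proj₂ last)

    isRLMin-r : isRLMin t r ≡ true
    isRLMin-r = isRLMin-complete t r λ j r<j j<n → subst (_< at t j) (sym at-r)
      (≤∧≢⇒< (k<at j (<-trans (<-trans (n<1+n k) sk<r) r<j) j<n) (λ e → ≡ᵇ≡false⇒≢ _ _ (proj₂ (proj₂ last) j r<j j<n) (sym e)))

    between : ∀ l → suc k ≤ l → l < r → isRLMin t l ≡ false
    between l sk≤l l<r with isRLMin t l in rl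
    ... | false = refl
    ... | true = ⊥-elim (<⇒≱ (isRLMin-sound t l rl r l<r r<n) (subst (_≤ at t l) (sym at-r) (k<at l sk≤l (<-trans l<r r<n))))

    Rest : List ℕ
    Rest = filterᵇ (isRLMin t) (segment (suc r) (suc k + (n ∸ suc k) ∸ suc r))

    rlminPos≡′ : rlminPos t ≡ segment 0 (suc k) ++ r ∷ Rest
    rlminPos≡′ = trans rlminPos≡ (cong (segment 0 (suc k) ++_)
      (filterᵇ-segment-first (isRLMin t) (suc k) (n ∸ suc k) r (<⇒≤ sk<r) (subst (r <_) (sym (m+[n∸m]≡n (<⇒≤ sk<n))) r<n) between isRLMin-r))

    suc-k<length : suc k < length (rlminPos t)
    suc-k<length = subst (λ l → suc k < length l) (sym rlminPos≡′)
      (subst (suc k <_) (sym (trans (length-++ (segment 0 (suc k)) {r ∷ Rest}) (cong (_+ suc (length Rest)) (length-segment 0 (suc k)))))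
        (subst (suc (suc k) ≤_) (sym (+-suc (suc k) (length Rest))) (s≤s (m≤m+n (suc k) (length Rest)))))

    at-rlminPos-k : at (rlminPos t) k ≡ k
    at-rlminPos-k = trans (cong (λ l → at l k) rlminPos≡′)
      (trans (at-++ˡ (segment 0 (suc k)) _ k (subst (k <_) (sym (length-segment 0 (suc k))) ≤-refl)) (at-segment 0 (suc k) k ≤-refl))

    Rmin-suc-k : at (Rmin t) (suc k) ≡ suc k
    Rmin-suc-k = trans (at-map (at t) (rlminPos t) (suc k) suc-k<length) (trans (cong (at t) at-rlminPos-suc-k) at-r)
      where
      at-rlminPos-suc-k : at (rlminPos t) (suc k) ≡ r
      at-rlminPos-suc-k = trans (cong (λ l → at l (suc k)) rlminPos≡′)
        (subst (λ z → at (segment 0 (suc k) ++ r ∷ Rest) z ≡ r) (trans (+-identityʳ _) (length-segment 0 (suc k))) (at-++ʳ (segment 0 (suc k)) (r ∷ Rest) 0))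

    rposOK-suc-k : rposOK t (suc k) ≡ true
    rposOK-suc-k = ≤⇒≤ᵇ≡true (subst (λ a → 2 ≤ count V (range (suc a) n)) (sym at-rlminPos-k)
      (subst (λ l → 2 ≤ count V l) (sym (range≡segment (suc k) n))
        (count-segment-two V (suc k) (n ∸ suc k) (suc k) r ≤-refl sk<r (subst (r <_) (sym (m+[n∸m]≡n (<⇒≤ sk<n))) r<n)
          (≡⇒≡ᵇ≡true (trans at-suc-k (sym Rmin-suc-k))) (≡⇒≡ᵇ≡true (trans at-r (sym Rmin-suc-k))))))
      where
      V : ℕ → Bool
      V j = at t j ≡ᵇ at (Rmin t) (suc k)

rposOK-after-identityPrefix : ∀ d t → IsAscent t → ¬ (rmin t ≡ length t) → ∀ k → length t ∸ k ≡ d → k < length t →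
  IdentityPrefix t k → Σ ℕ λ m → k < m × m < rmin t × rposOK t m ≡ true
rposOK-after-identityPrefix zero t hA r≢n k n∸k≡0 k<n pre = ⊥-elim (<⇒≱ k<n (m∸n≡0⇒m≤n n∸k≡0))
rposOK-after-identityPrefix (suc d) t hA r≢n k n∸k≡d k<n pre with suc k <? length t
... | no sk≮n = ⊥-elim (r≢n (all-isRLMin⇒rmin≡length t λ i _ i<n → proj₂ pre i (≤-pred (subst (i <_) (≤-antisym (≮⇒≥ sk≮n) k<n) i<n))))
... | yes sk<n with isRLMin t (suc k) in rl
...   | true =
  let (m , sk<m , rest) = rposOK-after-identityPrefix d t hA r≢n (suc k)
                            (suc-injective (trans (sym (m∸n≡suc[m∸1+n] (length t) k k<n)) n∸k≡d)) sk<n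
                            (AfterIdentityPrefix.extend t hA k pre sk<n rl)
  in m , <-trans (n<1+n k) sk<m , rest
...   | false with AfterIdentityPrefix.lastRepeat t hA k pre sk<n rl
...     | r , sk<r , last = suc k , n<1+n k , subst (suc k <_) (sym (rmin≡length-rlminPos t)) suc-k<length , rposOK-suc-k
  where open AfterIdentityPrefix.Repeated t hA k pre sk<n r sk<r last

rposOK-exists : ∀ t → IsAscent t → ¬ (rmin t ≡ length t) → Σ ℕ λ m → m < rmin t × rposOK t m ≡ true
rposOK-exists [] _ r≢n = ⊥-elim (r≢n refl)
rposOK-exists (x ∷ xs) (h0 , a) r≢n with rposOK (x ∷ xs) 0 in ok0
... | true = 0 , rmin>0 (x ∷ xs) (s≤s z≤n) , ok0
... | false =
  let (m , _ , m<rmin , ok) = rposOK-after-identityPrefix _ (x ∷ xs) (h0 , a) r≢n 0 refl (s≤s z≤n) ((λ { zero _ → h0 }) , (λ { zero _ → isRLMin-0 }))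
  in m , m<rmin , ok
  where
  no-later-0 : count (_≡ᵇ 0) xs ≡ 0
  no-later-0 with count (_≡ᵇ 0) xs in c
  ... | zero = refl
  ... | suc _ = ⊥-elim (true≢false (trans (sym ok) ok0))
    where
    ok : rposOK (x ∷ xs) 0 ≡ true
    ok = trans (cong (λ v → 2 ≤ᵇ count (_≡ᵇ v) (x ∷ xs)) (Rmin-head≡0 (x ∷ xs) (h0 , a) (s≤s z≤n)))
      (trans (cong (2 ≤ᵇ_) (count-∷ (_≡ᵇ 0) x xs))
      (trans (cong (λ b → 2 ≤ᵇ (χ b + count (_≡ᵇ 0) xs)) (≡⇒≡ᵇ≡true h0))
      (cong (λ c′ → 2 ≤ᵇ (1 + c′)) c)))
  isRLMin-0 : isRLMin (x ∷ xs) 0 ≡ true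
  isRLMin-0 = isRLMin-complete (x ∷ xs) 0 λ { (suc j) _ (s≤s j<n) → subst (_< at xs j) (sym h0)
     (n≢0⇒n>0 (λ e → <-irrefl refl (subst (0 <_) no-later-0 (at⇒count-pos (_≡ᵇ 0) xs j j<n (≡⇒≡ᵇ≡true e))))) }

IsAscent⇒rpos-isLast : ∀ s → IsAscent s → ¬ (rmin s ≡ length s) → IsLast (rposOK s) (rmin s) (rpos s)
IsAscent⇒rpos-isLast s hA r≢n with rposOK-exists s hA r≢n
... | m , m<rmin , ok = proj₁ (rpos-isLast s r≢n m m<rmin ok)

module RLMinAt (t : List ℕ) (p : ℕ) (pl : p < length t) (e : isRLMin t p ≡ true) where
  s : List ℕ
  s = dupAt p t

  A : List ℕ
  A = rlminPosBefore t p

  C : List ℕ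
  C = rlminPosAfter t p

  rank : ℕ
  rank = length A

  rlminPos≡ : rlminPos t ≡ A ++ p ∷ C
  rlminPos≡ = trans (rlminPos-split t p pl) (cong (A ++_) (rlminPosFrom-∷ t p pl e))

  rlminPos-dupAt≡ : rlminPos s ≡ A ++ suc p ∷ map suc C
  rlminPos-dupAt≡ = trans (rlminPos-dupAt t p pl) (cong (λ l → A ++ map suc l) (rlminPosFrom-∷ t p pl e))

  rmin≡ : rmin t ≡ rank + suc (length C)
  rmin≡ = trans (rmin≡length-rlminPos t) (trans (cong length rlminPos≡) (length-++ A))

  rank<rmin : rank < rmin t
  rank<rmin = subst (rank <_) (sym rmin≡) (subst (_≤ rank + suc (length C)) (+-comm rank 1) (+-monoʳ-≤ rank (s≤s z≤n)))

  at-rlminPos-rank : at (rlminPos t) rank ≡ p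
  at-rlminPos-rank = trans (cong (λ l → at l rank) rlminPos≡)
    (subst (λ z → at (A ++ p ∷ C) z ≡ p) (+-identityʳ rank) (at-++ʳ A (p ∷ C) 0))

  at-rlminPos-dupAt-rank : at (rlminPos s) rank ≡ suc p
  at-rlminPos-dupAt-rank = trans (cong (λ l → at l rank) rlminPos-dupAt≡)
    (subst (λ z → at (A ++ suc p ∷ map suc C) z ≡ suc p) (+-identityʳ rank) (at-++ʳ A (suc p ∷ map suc C) 0))

  at-rlminPos-< : ∀ j → j < rank → at (rlminPos t) j ≡ at A j
  at-rlminPos-< j h = trans (cong (λ l → at l j) rlminPos≡) (at-++ˡ A _ j h)

  at-rlminPos-dupAt-< : ∀ j → j < rank → at (rlminPos s) j ≡ at A j
  at-rlminPos-dupAt-< j h = trans (cong (λ l → at l j) rlminPos-dupAt≡) (at-++ˡ A _ j h)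

  at-A : ∀ j → j < rank → at A j < p × isRLMin t (at A j) ≡ true
  at-A j h = All-at A j (rlminPosBefore-All t p) h

  at-rlminPos-dupAt-+ : ∀ d → rank + d < rmin t →
    at (rlminPos s) (rank + d) ≡ suc (at (rlminPos t) (rank + d)) × p ≤ at (rlminPos t) (rank + d)
  at-rlminPos-dupAt-+ d h =
    trans (cong (λ l → at l (rank + d)) rlminPos-dupAt≡) (trans (at-++ʳ A _ d) (trans (at-map suc (p ∷ C) d d<) (cong suc (sym at-t)))) ,
    subst (p ≤_) (sym at-t) (p≤ d d<)
    where
    at-t : at (rlminPos t) (rank + d) ≡ at (p ∷ C) d
    at-t = trans (cong (λ l → at l (rank + d)) rlminPos≡) (at-++ʳ A _ d)
    d< : d < suc (length C)
    d< = +-cancelˡ-< rank d (suc (length C)) (subst (rank + d <_) rmin≡ h)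
    p≤ : ∀ d → d < suc (length C) → p ≤ at (p ∷ C) d
    p≤ zero _ = ≤-refl
    p≤ (suc d) (s≤s h) = <⇒≤ (proj₁ (All-at C d (rlminPosAfter-All t p pl) h))

  at-rlminPos-dupAt-≥ : ∀ m → rank ≤ m → m < rmin t →
    at (rlminPos s) m ≡ suc (at (rlminPos t) m) × p ≤ at (rlminPos t) m
  at-rlminPos-dupAt-≥ m rank≤m m<r = subst Shifted (m+[n∸m]≡n rank≤m)
    (at-rlminPos-dupAt-+ (m ∸ rank) (subst (_< rmin t) (sym (m+[n∸m]≡n rank≤m)) m<r))
    where
    Shifted : ℕ → Set
    Shifted z = at (rlminPos s) z ≡ suc (at (rlminPos t) z) × p ≤ at (rlminPos t) z

  Rmin-rank : at (Rmin t) rank ≡ at t p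
  Rmin-rank = trans (at-Rmin t rank rank<rmin) (cong (at t) at-rlminPos-rank)

  Rmin-<rank : ∀ j → j < rank → at (Rmin t) j < at t p
  Rmin-<rank j h = subst (_< at t p) (sym (trans (at-Rmin t j (<-trans h rank<rmin)) (cong (at t) (at-rlminPos-< j h))))
    (isRLMin-sound t (at A j) (proj₂ (at-A j h)) p (proj₁ (at-A j h)) pl)

  count-rposWindow-≤ : ∀ q m → m ≤ rank → count q (rposWindow s m) ≡ χ (q (at t p)) + count q (rposWindow t m)
  count-rposWindow-≤ q zero _ = count-dupAt q p t pl
  count-rposWindow-≤ q (suc m) m<rank = begin
      count q (drop (suc (at (rlminPos s) m)) s)
    ≡⟨ cong (λ a → count q (drop (suc a) s)) (at-rlminPos-dupAt-< m m<rank) ⟩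
      count q (drop (suc a) s)
    ≡⟨ cong (count q) (drop-dupAt-≤ p t (suc a) a<p) ⟩
      count q (dupAt (p ∸ suc a) (drop (suc a) t))
    ≡⟨ count-dupAt q (p ∸ suc a) (drop (suc a) t) (length-drop-suc> p a t a<p pl) ⟩
      χ (q (at (drop (suc a) t) (p ∸ suc a))) + count q (drop (suc a) t)
    ≡⟨ cong₂ (λ v a' → χ (q v) + count q (drop (suc a') t)) (at-drop-∸ t a<p) (sym (at-rlminPos-< m m<rank)) ⟩
      χ (q (at t p)) + count q (drop (suc (at (rlminPos t) m)) t)
    ∎
    where
    open ≡-Reasoning
    a : ℕ
    a = at A m
    a<p : a < p
    a<p = proj₁ (at-A m m<rank)

  at-p∈rposWindow : ∀ m → m ≤ rank → 1 ≤ count (_≡ᵇ at t p) (rposWindow t m)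
  at-p∈rposWindow zero _ = at⇒count-pos (_≡ᵇ at t p) t p pl (≡⇒≡ᵇ≡true {at t p} refl)
  at-p∈rposWindow (suc m) m<rank rewrite at-rlminPos-< m m<rank =
    at⇒count-pos (_≡ᵇ at t p) (drop (suc a) t) (p ∸ suc a) (length-drop-suc> p a t a<p pl) (≡⇒≡ᵇ≡true (at-drop-∸ t a<p))
    where
    a : ℕ
    a = at A m
    a<p : a < p
    a<p = proj₁ (at-A m m<rank)

  rposWindow-dupAt-> : ∀ m → rank < m → m < rmin t → rposWindow s m ≡ rposWindow t m
  rposWindow-dupAt-> (suc m) rank≤m m<r =
    trans (cong (λ b → drop (suc b) s) (proj₁ hi)) (drop-dupAt-≥ p t (suc (at (rlminPos t) m)) (m≤n⇒m≤1+n (proj₂ hi)) pl)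
    where
    hi : at (rlminPos s) m ≡ suc (at (rlminPos t) m) × p ≤ at (rlminPos t) m
    hi = at-rlminPos-dupAt-≥ m (≤-pred rank≤m) (<-trans (n<1+n m) m<r)

  rposOK-dupAt≡ : ∀ m → rposOK s m ≡ (2 ≤ᵇ count (_≡ᵇ at (Rmin t) m) (rposWindow s m))
  rposOK-dupAt≡ m = trans (rposOK≡ s m) (cong (λ R → 2 ≤ᵇ count (_≡ᵇ at R m) (rposWindow s m)) (Rmin-dupAt t p pl))

  rposOK-dupAt-rank : rposOK s rank ≡ true
  rposOK-dupAt-rank = trans (rposOK-dupAt≡ rank)
    (trans (cong (λ v → 2 ≤ᵇ count (_≡ᵇ v) (rposWindow s rank)) Rmin-rank)
    (trans (cong (2 ≤ᵇ_) (count-rposWindow-≤ (_≡ᵇ at t p) rank ≤-refl)) (≤⇒≤ᵇ≡true two)))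
    where
    two : 2 ≤ χ (at t p ≡ᵇ at t p) + count (_≡ᵇ at t p) (rposWindow t rank)
    two rewrite ≡⇒≡ᵇ≡true {at t p} refl = s≤s (at-p∈rposWindow rank ≤-refl)

  rposOK-dupAt-≢rank : ∀ m → m < rmin t → ¬ (m ≡ rank) → rposOK s m ≡ rposOK t m
  rposOK-dupAt-≢rank m m<r m≢rank with <-cmp m rank
  ... | tri< m<rank _ _ = trans (rposOK-dupAt≡ m)
    (trans (cong (2 ≤ᵇ_) (trans (count-rposWindow-≤ _ m (<⇒≤ m<rank))
      (cong (λ b → χ b + count (_≡ᵇ at (Rmin t) m) (rposWindow t m)) (≢⇒≡ᵇ≡false (λ h → <-irrefl (sym h) (Rmin-<rank m m<rank))))))
    (sym (rposOK≡ t m)))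
  ... | tri≈ _ m≡rank _ = ⊥-elim (m≢rank m≡rank)
  ... | tri> _ _ rank<m = trans (rposOK-dupAt≡ m)
    (trans (cong (λ w → 2 ≤ᵇ count (_≡ᵇ at (Rmin t) m) w) (rposWindow-dupAt-> m rank<m m<r)) (sym (rposOK≡ t m)))

rpos≤rank : ∀ t p (pl : p < length t) (e : isRLMin t p ≡ true) → IsAscent t → ¬ (rmin t ≡ length t) →
  RLMinAt.rank t p pl e ≡ rpos (dupAt p t) → rpos t ≤ RLMinAt.rank t p pl e
rpos≤rank t p pl e hA r≢n rank≡ with rpos t ≤? RLMinAt.rank t p pl e
... | yes h = h
... | no h = ⊥-elim (<⇒≱ (≰⇒> h) (subst (rpos t ≤_) (sym rank≡)
           (proj₂ (rpos-isLast (dupAt p t) (rmin-dupAt≢length t p pl) (rpos t) (subst (rpos t <_) (sym (rmin-dupAt t p pl)) rpos<rmin) ok-dupAt))))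
  where
  rpos-last : IsLast (rposOK t) (rmin t) (rpos t)
  rpos-last = IsAscent⇒rpos-isLast t hA r≢n
  rpos<rmin : rpos t < rmin t
  rpos<rmin = proj₁ (proj₂ rpos-last)
  ok-dupAt : rposOK (dupAt p t) (rpos t) ≡ true
  ok-dupAt = trans (RLMinAt.rposOK-dupAt-≢rank t p pl e (rpos t) rpos<rmin (λ e' → h (≤-reflexive e'))) (proj₁ rpos-last)

fixedRLMin⇒identityPrefix : ∀ t → IsAscent t → ∀ p → p < length t → isRLMin t p ≡ true → at t p ≡ p → IdentityPrefix t p
fixedRLMin⇒identityPrefix t hA p p<n rl tp≡p = identity , rlmin
  where
  identity : ∀ l → l ≤ p → at t l ≡ l
  identity = fixedPoint⇒prefix-identity t hA p p<n tp≡p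
  rlmin : ∀ l → l ≤ p → isRLMin t l ≡ true
  rlmin l l≤p with m≤n⇒m<n∨m≡n l≤p
  ... | inj₂ refl = rl
  ... | inj₁ l<p = isRLMin-complete t l later
    where
    later : ∀ j → l < j → j < length t → at t l < at t j
    later j l<j j<n with j ≤? p
    ... | yes j≤p = subst₂ _<_ (sym (identity l l≤p)) (sym (identity j j≤p)) l<j
    ... | no j≰p = subst (_< at t j) (sym (identity l l≤p)) (≤-<-trans (subst (l ≤_) (sym tp≡p) l≤p) (isRLMin-sound t p rl j (≰⇒> j≰p) j<n))

at≢index : ∀ t → IsAscent t → ¬ (rmin t ≡ length t) → ∀ p → (pl : p < length t) → (e : isRLMin t p ≡ true) →
  rpos t ≤ RLMinAt.rank t p pl e → ¬ (at t p ≡ p)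
at≢index t hA r≢n p pl e rpos≤rank tp≡p
  with rposOK-after-identityPrefix _ t hA r≢n p refl pl (fixedRLMin⇒identityPrefix t hA p pl e tp≡p)
... | m , p<m , m<rmin , ok = <⇒≱ p<m (≤-trans (proj₂ (rpos-isLast t r≢n m m<rmin ok)) (subst (rpos t ≤_) rank≡p rpos≤rank))
  where
  rank≡p : RLMinAt.rank t p pl e ≡ p
  rank≡p = trans (cong length (filterᵇ-segment-all (isRLMin t) 0 p (λ l _ l<p → proj₂ (fixedRLMin⇒identityPrefix t hA p pl e tp≡p) l (<⇒≤ l<p)))) (length-segment 0 p)

at≡0⇔index≡0 : ∀ t → IsAscent t → ∀ p → (pl : p < length t) → (e : isRLMin t p ≡ true) → (at t p ≡ᵇ 0) ≡ (RLMinAt.rank t p pl e ≡ᵇ 0)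
at≡0⇔index≡0 t hA p pl e with RLMinAt.rank t p pl e in ie
... | zero = ≡⇒≡ᵇ≡true (trans (sym (trans (at-Rmin t 0 (subst (_< rmin t) ie (RLMinAt.rank<rmin t p pl e))) (cong (at t) (subst (λ z → at (rlminPos t) z ≡ p) ie (RLMinAt.at-rlminPos-rank t p pl e))))) (Rmin-head≡0 t hA (≤-<-trans z≤n pl)))
... | suc _ = ≢⇒≡ᵇ≡false (λ h → <-irrefl refl (subst₂ _<_ (Rmin-head≡0 t hA (≤-<-trans z≤n pl)) h (RLMinAt.Rmin-<rank t p pl e 0 (subst (0 <_) (sym ie) (s≤s z≤n)))))

-- Statistics of a duplication

zeros-dupAt : ∀ p t → p < length t → zeros (dupAt p t) ≡ χ (at t p ≡ᵇ 0) + zeros t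
zeros-dupAt p t pl = count-dupAt (_≡ᵇ 0) p t pl

isIdentity-dupAt : ∀ p t → p < length t → isIdentity (dupAt p t) ≡ false
isIdentity-dupAt p t pl with isIdentity (dupAt p t) in id-s
... | false = refl
... | true = ⊥-elim (<-irrefl (sym sp≡p) (n<1+n p))
  where
  identity : ∀ i → i < length (dupAt p t) → at (dupAt p t) i ≡ i
  identity i h = ≡ᵇ≡true⇒≡ _ _ (all-segment-elim (λ i → at (dupAt p t) i ≡ᵇ i) 0 (length (dupAt p t))
    (trans (cong (all (λ i → at (dupAt p t) i ≡ᵇ i)) (sym (upTo≡segment (length (dupAt p t))))) id-s) i z≤n h)
  sp≡p : suc p ≡ p
  sp≡p = begin
    suc p                ≡⟨ sym (identity (suc p) (subst (suc p <_) (sym (length-dupAt p t pl)) (s≤s pl))) ⟩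
    at (dupAt p t) (suc p) ≡⟨ at-dupAt-≥ p t p ≤-refl pl ⟩
    at t p               ≡⟨ sym (at-dupAt-≤ p t p ≤-refl) ⟩
    at (dupAt p t) p     ≡⟨ identity p (subst (p <_) (sym (length-dupAt p t pl)) (<-trans pl (n<1+n _))) ⟩
    p                    ∎
    where open ≡-Reasoning

maxs-dupAt : ∀ t → IsAscent t → ∀ p → p < length t → ¬ (at t p ≡ p) → maxs (dupAt p t) ≡ maxs t × maxs t ≤ p
maxs-dupAt t hA p p<n tp≢p =
  count-dupAt-indices (λ i → at (dupAt p t) i ≡ᵇ i) (λ i → at t i ≡ᵇ i) p t p<n
    (λ i i≤p → cong (_≡ᵇ i) (at-dupAt-≤ p t i i≤p))
    (≢⇒≡ᵇ≡false (λ h → not-above p (trans (sym (at-dupAt-≥ p t p ≤-refl p<n)) h)))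
    (λ k p<k k<n → trans (≢⇒≡ᵇ≡false (λ h → not-above k (trans (sym (at-dupAt-≥ p t k (<⇒≤ p<k) p<n)) h)))
                         (sym (not-fixed k (<⇒≤ p<k) k<n))) ,
  count-upTo-≤ (λ i → at t i ≡ᵇ i) (length t) p (<⇒≤ p<n) not-fixed
  where
  not-above : ∀ k → ¬ (at t k ≡ suc k)
  not-above k h = <-irrefl refl (≤-trans (s≤s (at≤index t hA k)) (≤-reflexive (sym h)))
  not-fixed : ∀ k → p ≤ k → k < length t → (at t k ≡ᵇ k) ≡ false
  not-fixed k p≤k k<n = ≢⇒≡ᵇ≡false (λ h → tp≢p (fixedPoint⇒prefix-identity t hA k k<n h p p≤k))

ealm-dupAt : ∀ t → IsAscent t → ∀ p → p < length t → ¬ (at t p ≡ p) → ealm (dupAt p t) ≡ ealm t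
ealm-dupAt t hA p p<n tp≢p = begin
    (if maxs s ≡ᵇ length s then 0 else at s (maxs s))
  ≡⟨ cong (λ M → if M ≡ᵇ length s then 0 else at s M) maxs≡ ⟩
    (if maxs t ≡ᵇ length s then 0 else at s (maxs t))
  ≡⟨ cong₂ (λ b x → if b then 0 else x) (≢⇒≡ᵇ≡false (λ h → M≢ (length s) (subst (p <_) (sym (length-dupAt p t p<n)) (m≤n⇒m≤1+n p<n)) h))
                                        (at-dupAt-≤ p t (maxs t) M≤p) ⟩
    at t (maxs t)
  ≡⟨ cong (λ b → if b then 0 else at t (maxs t)) (sym (≢⇒≡ᵇ≡false (M≢ (length t) p<n))) ⟩
    (if maxs t ≡ᵇ length t then 0 else at t (maxs t))
  ∎
  where
  open ≡-Reasoning
  s : List ℕ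
  s = dupAt p t
  maxs≡ : maxs s ≡ maxs t
  maxs≡ = proj₁ (maxs-dupAt t hA p p<n tp≢p)
  M≤p : maxs t ≤ p
  M≤p = proj₂ (maxs-dupAt t hA p p<n tp≢p)
  M≢ : ∀ m → p < m → ¬ (maxs t ≡ m)
  M≢ m p<m h = <-irrefl refl (≤-trans (s≤s (subst (_≤ p) h M≤p)) p<m)

isFirstOccurrence : List ℕ → ℕ → Bool
isFirstOccurrence s i = not (any (λ j → at s j ≡ᵇ at s i) (upTo i))

isFirstOccurrence-take : ∀ s i → i ≤ length s → isFirstOccurrence s i ≡ not (any (_≡ᵇ at s i) (take i s))
isFirstOccurrence-take s i h = cong not (trans (cong (any (λ j → at s j ≡ᵇ at s i)) (upTo≡segment i))
  (trans (sym (any-map (_≡ᵇ at s i) (at s) (segment 0 i))) (cong (any (_≡ᵇ at s i)) (map-at-segment s 0 i h))))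

distinctValues : List ℕ → ℕ
distinctValues s = count (isFirstOccurrence s) (upTo (length s))

distinctValues-dupAt : ∀ p t → p < length t → distinctValues (dupAt p t) ≡ distinctValues t
distinctValues-dupAt p t p<n = count-dupAt-indices (isFirstOccurrence s) (isFirstOccurrence t) p t p<n below copy above
  where
  s : List ℕ
  s = dupAt p t
  length-s : length s ≡ suc (length t)
  length-s = length-dupAt p t p<n
  below : ∀ i → i ≤ p → isFirstOccurrence s i ≡ isFirstOccurrence t i
  below i i≤p = trans (isFirstOccurrence-take s i (subst (i ≤_) (sym length-s) (≤-trans i≤p (<⇒≤ (<-trans p<n (n<1+n _))))))
    (trans (cong₂ (λ x l → not (any (_≡ᵇ x) l)) (at-dupAt-≤ p t i i≤p) (take-dupAt-≤ p t i i≤p))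
    (sym (isFirstOccurrence-take t i (≤-trans i≤p (<⇒≤ p<n)))))
  copy : isFirstOccurrence s (suc p) ≡ false
  copy = trans (isFirstOccurrence-take s (suc p) (subst (suc p ≤_) (sym length-s) (s≤s (<⇒≤ p<n))))
    (trans (cong₂ (λ x l → not (any (_≡ᵇ x) l)) (at-dupAt-≥ p t p ≤-refl p<n) (trans (take-dupAt-suc p t) (take-suc≡take∷ʳat t p p<n)))
    (cong not (any-∷ʳ-self (take p t) (at t p))))
  above : ∀ k → p < k → k < length t → isFirstOccurrence s (suc k) ≡ isFirstOccurrence t k
  above k p<k k<n = trans (isFirstOccurrence-take s (suc k) (subst (suc k ≤_) (sym length-s) (s≤s (<⇒≤ k<n))))
    (trans (cong₂ (λ x l → not (any (_≡ᵇ x) l)) (at-dupAt-≥ p t k (<⇒≤ p<k) p<n) (take-dupAt-> p t k p<k))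
    (trans (cong not (any-dupAt (_≡ᵇ at t k) p (take k t)))
    (sym (isFirstOccurrence-take t k (<⇒≤ k<n)))))

rep-dupAt : ∀ p t → p < length t → rep (dupAt p t) ≡ rep t + 1
rep-dupAt p t p<n = trans (cong₂ _∸_ (length-dupAt p t p<n) (distinctValues-dupAt p t p<n))
  (trans (+-∸-assoc 1 distinct≤length) (+-comm 1 (length t ∸ distinctValues t)))
  where
  distinct≤length : distinctValues t ≤ length t
  distinct≤length = subst (distinctValues t ≤_) (length-upTo (length t)) (count≤length (isFirstOccurrence t) (upTo (length t)))

-- The statistic sebr

rposValueAt : List ℕ → ℕ → Bool
rposValueAt s j = at s j ≡ᵇ at (Rmin s) (rpos s)

occurrencesOfRposValue : List ℕ → List ℕ
occurrencesOfRposValue s = reverse (filterᵇ (rposValueAt s) (upTo (length s)))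

sebr-occurrences : ∀ s R q rest → occurrencesOfRposValue s ≡ R ∷ q ∷ rest →
  sebr s ≡ (if R ≡ᵇ suc q then 0 else minimumOr0 (map (at s) (range (suc q) R)))
sebr-occurrences s R q rest e with occurrencesOfRposValue s | e
... | .(R ∷ q ∷ rest) | refl = refl

sebr-lastTwo : ∀ s q R → q < R → R < length s → rposValueAt s q ≡ true → rposValueAt s R ≡ true →
  (∀ j → q < j → j < R → rposValueAt s j ≡ false) → (∀ j → R < j → j < length s → rposValueAt s j ≡ false) →
  sebr s ≡ (if R ≡ᵇ suc q then 0 else minimumOr0 (map (at s) (range (suc q) R)))
sebr-lastTwo s q R q<R R<n Pq PR between after = sebr-occurrences s R q (reverse X)
  (trans (cong reverse (trans (cong (filterᵇ (rposValueAt s)) (upTo≡segment (length s)))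
                              (filterᵇ-lastTwo (rposValueAt s) (length s) q R q<R R<n Pq PR between after)))
         (reverse-++ X (q ∷ R ∷ [])))
  where
  X : List ℕ
  X = filterᵇ (rposValueAt s) (segment 0 q)

sebr-dupAt : ∀ t p → (pl : p < length t) → isRLMin t p ≡ true → at (Rmin (dupAt p t)) (rpos (dupAt p t)) ≡ at t p → sebr (dupAt p t) ≡ 0
sebr-dupAt t p pl e Rmin-rpos≡ =
  trans (sebr-lastTwo s p (suc p) ≤-refl (subst (suc p <_) (sym (length-dupAt p t pl)) (s≤s pl))
          (≡⇒≡ᵇ≡true (trans (at-dupAt-≤ p t p ≤-refl) (sym Rmin-rpos≡)))
          (≡⇒≡ᵇ≡true (trans (at-dupAt-≥ p t p ≤-refl pl) (sym Rmin-rpos≡)))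
          (λ j p<j j<sp → ⊥-elim (<-irrefl refl (≤-trans j<sp p<j))) after)
        (cong (λ b → if b then 0 else minimumOr0 (map (at s) (range (suc p) (suc p)))) (≡⇒≡ᵇ≡true {suc p} refl))
  where
  s : List ℕ
  s = dupAt p t
  after : ∀ j → suc p < j → j < length s → rposValueAt s j ≡ false
  after (suc k) (s≤s p<k) sk<n = ≢⇒≡ᵇ≡false λ h →
    <-irrefl (sym (trans (sym (at-dupAt-≥ p t k (<⇒≤ p<k) pl)) (trans h Rmin-rpos≡)))
             (isRLMin-sound t p e k p<k (≤-pred (subst (suc k <_) (length-dupAt p t pl) sk<n)))

sebr≡0⇒adjacent : ∀ s q R → q < R → sebr s ≡ (if R ≡ᵇ suc q then 0 else minimumOr0 (map (at s) (range (suc q) R))) →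
  sebr s ≡ 0 → (∀ j → q < j → j < R → 0 < at s j) → suc q ≡ R
sebr≡0⇒adjacent s q R q<R sebr≡ sebr≡0 pos with R ≡ᵇ suc q in R≡sq
... | true = sym (≡ᵇ≡true⇒≡ _ _ R≡sq)
... | false = ⊥-elim (<-irrefl (trans (sym sebr≡0) sebr≡) (minimumOr0-pos s (suc q) R sq<R pos))
  where
  sq<R : suc q < R
  sq<R with m≤n⇒m<n∨m≡n q<R
  ... | inj₁ h = h
  ... | inj₂ h = ⊥-elim (≡ᵇ≡false⇒≢ _ _ R≡sq (sym h))

module RposOccurrences (s : List ℕ) (hA : IsAscent s) (r≢n : ¬ (rmin s ≡ length s)) where
  n : ℕ
  n = length s

  rpos<length : rpos s < length (rlminPos s)
  rpos<length = subst (rpos s <_) (rmin≡length-rlminPos s) (proj₁ (proj₂ (IsAscent⇒rpos-isLast s hA r≢n)))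

  R : ℕ
  R = at (rlminPos s) (rpos s)

  R<n : R < n
  R<n = proj₁ (rlminPos-at s (rpos s) rpos<length)

  Rmin-rpos≡ : at (Rmin s) (rpos s) ≡ at s R
  Rmin-rpos≡ = at-map (at s) (rlminPos s) (rpos s) rpos<length

  value-R : rposValueAt s R ≡ true
  value-R = ≡⇒≡ᵇ≡true (sym Rmin-rpos≡)

  after-R : ∀ j → R < j → j < n → rposValueAt s j ≡ false
  after-R j R<j j<n = ≢⇒≡ᵇ≡false λ h →
    <-irrefl (trans (sym Rmin-rpos≡) (sym h)) (isRLMin-sound s R (proj₂ (rlminPos-at s (rpos s) rpos<length)) j R<j j<n)

  lo : ℕ
  lo = windowStart s (rpos s)

  two-in-window : 2 ≤ count (rposValueAt s) (segment lo (n ∸ lo))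
  two-in-window = ≤ᵇ≡true⇒≤ 2 _ (trans (cong (2 ≤ᵇ_) (trans (cong (count (rposValueAt s)) (sym (range≡segment lo n)))
    (count-at-range (_≡ᵇ at (Rmin s) (rpos s)) s lo))) (trans (sym (rposOK≡ s (rpos s))) (proj₁ (IsAscent⇒rpos-isLast s hA r≢n))))

  window-facts : ∀ m → m ≡ rpos s →
    windowStart s m ≤ R × (∀ j → windowStart s m ≤ j → j < n → rposValueAt s j ≡ false → 0 < at s j)
  window-facts zero 0≡rpos = z≤n , λ j _ j<n other → n≢0⇒n>0 λ tj≡0 →
    true≢false (trans (sym (≡⇒≡ᵇ≡true (trans tj≡0 (sym (trans (cong (at (Rmin s)) (sym 0≡rpos)) (Rmin-head≡0 s hA (≤-<-trans z≤n R<n))))))) other)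
  window-facts (suc m) sm≡rpos =
    subst (λ z → at (rlminPos s) m < at (rlminPos s) z) sm≡rpos (rlminPos-increasing s m (suc m) ≤-refl sm<length) ,
    λ j P<j j<n _ → ≤-<-trans z≤n (isRLMin-sound s (at (rlminPos s) m) (proj₂ (rlminPos-at s m m<length)) j P<j j<n)
    where
    sm<length : suc m < length (rlminPos s)
    sm<length = subst (_< length (rlminPos s)) (sym sm≡rpos) rpos<length
    m<length : m < length (rlminPos s)
    m<length = <-trans (n<1+n m) sm<length

  lo≤R : lo ≤ R
  lo≤R = proj₁ (window-facts (rpos s) refl)

  one-before-R : 1 ≤ count (rposValueAt s) (segment lo (R ∸ lo))
  one-before-R = ≤-pred (subst (2 ≤_) (trans split (+-comm _ 1)) two-in-window)
    where
    lo≤n : lo ≤ n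
    lo≤n = ≤-trans lo≤R (<⇒≤ R<n)
    split : count (rposValueAt s) (segment lo (n ∸ lo)) ≡ count (rposValueAt s) (segment lo (R ∸ lo)) + 1
    split = trans (cong (count (rposValueAt s)) (segment-split lo (n ∸ lo) R lo≤R (subst (R ≤_) (sym (m+[n∸m]≡n lo≤n)) (<⇒≤ R<n))))
      (trans (count-++ (rposValueAt s) (segment lo (R ∸ lo)) _)
      (cong (count (rposValueAt s) (segment lo (R ∸ lo)) +_)
        (trans (cong (λ m → count (rposValueAt s) (segment R m)) (trans (cong (_∸ R) (m+[n∸m]≡n lo≤n)) (m∸n≡suc[m∸1+n] n R R<n)))
        (trans (count-∷ (rposValueAt s) R _) (trans (cong (λ b → χ b + count (rposValueAt s) (segment (suc R) (n ∸ suc R))) value-R)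
          (cong suc (count-segment-none (rposValueAt s) (suc R) (n ∸ suc R) (λ j R<j j< → after-R j R<j (subst (j <_) (m+[n∸m]≡n R<n) j<)))))))))

  previous : Σ ℕ λ q → lo ≤ q × IsLast (rposValueAt s) R q
  previous with count-segment-witness (rposValueAt s) lo (R ∸ lo) one-before-R
  ... | a , lo≤a , a< , value-a with lastOccurrence (rposValueAt s) a R (subst (a <_) (m+[n∸m]≡n lo≤R) a<) value-a
  ...   | q , a≤q , last = q , ≤-trans lo≤a a≤q , last

sebr≡0⇒repeatedPair : ∀ s → IsAscent s → ¬ (rmin s ≡ length s) → sebr s ≡ 0 →
  Σ ℕ λ q → suc q ≡ at (rlminPos s) (rpos s) × at s q ≡ at s (suc q) × suc q < length s
sebr≡0⇒repeatedPair s hA r≢n sebr≡0 = q , sq≡R , at-q≡ , subst (_< length s) (sym sq≡R) R<n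
  where
  open RposOccurrences s hA r≢n
  q : ℕ
  q = proj₁ previous
  q-last : IsLast (rposValueAt s) R q
  q-last = proj₂ (proj₂ previous)
  sq≡R : suc q ≡ R
  sq≡R = sebr≡0⇒adjacent s q R (proj₁ (proj₂ q-last))
    (sebr-lastTwo s q R (proj₁ (proj₂ q-last)) R<n (proj₁ q-last) value-R (proj₂ (proj₂ q-last)) after-R) sebr≡0
    λ j q<j j<R → proj₂ (window-facts (rpos s) refl) j (≤-trans (proj₁ (proj₂ previous)) (<⇒≤ q<j)) (<-trans j<R R<n) (proj₂ (proj₂ q-last) j q<j j<R)
  at-q≡ : at s q ≡ at s (suc q)
  at-q≡ = trans (≡ᵇ≡true⇒≡ _ _ (proj₁ q-last)) (trans Rmin-rpos≡ (cong (at s) (sym sq≡R)))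

-- The bijection

record Statistics (s t : List ℕ) : Set where
  field
    sasc : asc s ≡ asc t
    smax : maxs s ≡ maxs t
    sealm : ealm s ≡ ealm t
    srmin : rmin s ≡ rmin t
    szero : zeros s ≡ zeros t + χrpos0 s
    srep : rep s ≡ rep t + 1

module Duplicate (t : List ℕ) (p : ℕ) (pl : p < length t) (e : isRLMin t p ≡ true)
                 (isAscent-t : isAscent t ≡ true) (rmin-t≢length : ¬ (rmin t ≡ length t))
                 (rpos-t≤rank : rpos t ≤ RLMinAt.rank t p pl e) where
  open RLMinAt t p pl e using (s; rank; rank<rmin; Rmin-rank; rposOK-dupAt-rank; rposOK-dupAt-≢rank)

  hA : IsAscent t
  hA = isAscent-sound t isAscent-t

  rpos-s-isLast : IsLast (rposOK s) (rmin s) (rpos s) × rank ≤ rpos s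
  rpos-s-isLast = rpos-isLast s (rmin-dupAt≢length t p pl) rank (subst (rank <_) (sym (rmin-dupAt t p pl)) rank<rmin) rposOK-dupAt-rank

  rpos-dupAt : rpos s ≡ rank
  rpos-dupAt with m≤n⇒m<n∨m≡n (proj₂ rpos-s-isLast)
  ... | inj₂ h = sym h
  ... | inj₁ rank<rpos = ⊥-elim (<⇒≱ rank<rpos (≤-trans (proj₂ (rpos-isLast t rmin-t≢length (rpos s) rpos<rmin okt)) rpos-t≤rank))
    where
    rpos<rmin : rpos s < rmin t
    rpos<rmin = subst (rpos s <_) (rmin-dupAt t p pl) (proj₁ (proj₂ (proj₁ rpos-s-isLast)))
    okt : rposOK t (rpos s) ≡ true
    okt = trans (sym (rposOK-dupAt-≢rank (rpos s) rpos<rmin (λ h → <-irrefl (sym h) rank<rpos))) (proj₁ (proj₁ rpos-s-isLast))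

  at≢p : ¬ (at t p ≡ p)
  at≢p = at≢index t hA rmin-t≢length p pl e rpos-t≤rank

  zeros-dupAt≡ : zeros s ≡ zeros t + χrpos0 s
  zeros-dupAt≡ = begin
      zeros s                               ≡⟨ zeros-dupAt p t pl ⟩
      χ (at t p ≡ᵇ 0) + zeros t             ≡⟨ cong (λ b → χ b + zeros t) (at≡0⇔index≡0 t hA p pl e) ⟩
      χ (rank ≡ᵇ 0) + zeros t               ≡⟨ +-comm _ (zeros t) ⟩
      zeros t + χ (rank ≡ᵇ 0)               ≡⟨ cong (λ z → zeros t + χ (z ≡ᵇ 0)) (sym rpos-dupAt) ⟩
      zeros t + χrpos0 s                    ∎
    where open ≡-Reasoning

  statistics : Statistics s t
  statistics = record
    { sasc = asc-dupAt p t pl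
    ; smax = proj₁ (maxs-dupAt t hA p pl at≢p)
    ; sealm = ealm-dupAt t hA p pl at≢p
    ; srmin = rmin-dupAt t p pl
    ; szero = zeros-dupAt≡
    ; srep = rep-dupAt p t pl
    }

  Rmin-rpos-dupAt : at (Rmin s) (rpos s) ≡ at t p
  Rmin-rpos-dupAt = trans (cong₂ at (Rmin-dupAt t p pl) rpos-dupAt) Rmin-rank

  inAstar-dupAt : inAstar s ≡ true
  inAstar-dupAt = cong₂ (λ a b → a ∧ not b) (trans (isAscent-dupAt p t pl) isAscent-t) (isIdentity-dupAt p t pl)

  inT1-dupAt : inT1 s ≡ false
  inT1-dupAt = trans (cong (_∧ (length s ≡ᵇ suc (rmin s))) inAstar-dupAt)
    (trans (cong₂ (λ a b → a ≡ᵇ suc b) (length-dupAt p t pl) (rmin-dupAt t p pl)) (≢⇒≡ᵇ≡false (λ h → rmin-t≢length (sym (suc-injective h)))))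

  inT2-dupAt : inT2 s ≡ true
  inT2-dupAt = trans (cong₂ (λ a b → a ∧ not b ∧ (sebr s ≡ᵇ 0)) inAstar-dupAt inT1-dupAt) (≡⇒≡ᵇ≡true (sebr-dupAt t p pl e Rmin-rpos-dupAt))

inAstar⇒rmin≢length : ∀ t → inAstar t ≡ true → ¬ (rmin t ≡ length t)
inAstar⇒rmin≢length t h r≡n =
  true≢false (trans (sym (rmin≡length⇒isIdentity t (isAscent-sound t (∧≡true⇒ˡ h)) r≡n)) (not≡true⇒≡false (∧≡true⇒ʳ {isAscent t} h)))

rmin≢length⇒inAstar : ∀ t → isAscent t ≡ true → ¬ (rmin t ≡ length t) → inAstar t ≡ true
rmin≢length⇒inAstar t asc-t r≢n with isIdentity t in id-t
... | false = cong (_∧ true) asc-t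
... | true = ⊥-elim (r≢n (isIdentity⇒rmin≡length t id-t))

module FromCod (n : ℕ) (y : Cod n) where
  i : ℕ
  i = proj₁ y

  t : List ℕ
  t = proj₁ (proj₂ y)

  inAstar-t : inAstar t ≡ true
  inAstar-t = T⇒≡true (proj₁ (proj₂ (proj₂ y)))

  i<length : i < length (rlminPos t)
  i<length = subst (i <_) (rmin≡length-rlminPos t) (proj₂ (proj₂ (proj₂ (proj₂ (proj₂ y)))))

  p : ℕ
  p = at (rlminPos t) i

  p<length : p < length t
  p<length = proj₁ (rlminPos-at t i i<length)

  isRLMin-p : isRLMin t p ≡ true
  isRLMin-p = proj₂ (rlminPos-at t i i<length)

  open RLMinAt t p p<length isRLMin-p public using (rank; rank<rmin; at-rlminPos-rank; at-rlminPos-dupAt-rank)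

  rank≡i : rank ≡ i
  rank≡i = increasing-injective (rlminPos t) (rlminPos-increasing t) rank i
    (subst (rank <_) (rmin≡length-rlminPos t) rank<rmin) i<length at-rlminPos-rank

  open Duplicate t p p<length isRLMin-p (∧≡true⇒ˡ inAstar-t) (inAstar⇒rmin≢length t inAstar-t)
    (subst (rpos t ≤_) (sym rank≡i) (proj₁ (proj₂ (proj₂ (proj₂ (proj₂ y)))))) public

  length-dupAt≡n : 2 ≤ n → length (dupAt p t) ≡ n
  length-dupAt≡n 2≤n = trans (length-dupAt p t p<length) (trans (cong suc (proj₁ (proj₂ (proj₂ (proj₂ y))))) (m+[n∸m]≡n {1} (≤-trans (s≤s z≤n) 2≤n)))

fromCod : ∀ n → 2 ≤ n → Cod n → Dom n
fromCod n 2≤n y = dupAt p t , ≡true⇒T inT2-dupAt , length-dupAt≡n 2≤n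
  where open FromCod n y

-- For s ∈ 𝒯₂ the two rightmost copies of Rmin(s)_rpos(s) sit at deletionPoint s and the
-- position of the rpos(s)-th right-to-left minimum just after it.
deletionPoint : List ℕ → ℕ
deletionPoint s = pred (at (rlminPos s) (rpos s))

module FromDom (n : ℕ) (x : Dom n) where
  s : List ℕ
  s = proj₁ x

  inT2-s : inT2 s ≡ true
  inT2-s = T⇒≡true (proj₁ (proj₂ x))

  inAstar-s : inAstar s ≡ true
  inAstar-s = ∧≡true⇒ˡ inT2-s

  inT1-s : inT1 s ≡ false
  inT1-s = not≡true⇒≡false (∧≡true⇒ˡ (∧≡true⇒ʳ {inAstar s} inT2-s))

  ascent-s : IsAscent s
  ascent-s = isAscent-sound s (∧≡true⇒ˡ inAstar-s)

  rmin-s≢length : ¬ (rmin s ≡ length s)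
  rmin-s≢length = inAstar⇒rmin≢length s inAstar-s

  pair : Σ ℕ λ q → suc q ≡ at (rlminPos s) (rpos s) × at s q ≡ at s (suc q) × suc q < length s
  pair = sebr≡0⇒repeatedPair s ascent-s rmin-s≢length
    (≡ᵇ≡true⇒≡ _ _ (∧≡true⇒ʳ {not (inT1 s)} (∧≡true⇒ʳ {inAstar s} inT2-s)))

  q : ℕ
  q = proj₁ pair

  deletionPoint≡q : deletionPoint s ≡ q
  deletionPoint≡q = cong pred (sym (proj₁ (proj₂ pair)))

  t : List ℕ
  t = delAt q s

  dupAt-delAt≡s : dupAt q t ≡ s
  dupAt-delAt≡s = dupAt-delAt q s (proj₂ (proj₂ (proj₂ pair))) (proj₁ (proj₂ (proj₂ pair)))

  length-t : suc (length t) ≡ length s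
  length-t = length-delAt q s (<-trans (n<1+n q) (proj₂ (proj₂ (proj₂ pair))))

  q<length : q < length t
  q<length = ≤-pred (subst (suc q <_) (sym length-t) (proj₂ (proj₂ (proj₂ pair))))

  rpos<rmin : rpos s < rmin s
  rpos<rmin = proj₁ (proj₂ (IsAscent⇒rpos-isLast s ascent-s rmin-s≢length))

  rpos<length : rpos s < length (rlminPos s)
  rpos<length = subst (rpos s <_) (rmin≡length-rlminPos s) rpos<rmin

  isRLMin-q : isRLMin t q ≡ true
  isRLMin-q = trans (sym (isRLMin-dupAt-≥ q t q ≤-refl q<length))
    (subst (λ z → isRLMin z (suc q) ≡ true) (sym dupAt-delAt≡s)
      (subst (λ z → isRLMin s z ≡ true) (sym (proj₁ (proj₂ pair))) (proj₂ (rlminPos-at s (rpos s) rpos<length))))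

  open RLMinAt t q q<length isRLMin-q public using (rank; rank<rmin; at-rlminPos-rank; at-rlminPos-dupAt-rank)

  rmin-s≡ : rmin s ≡ rmin t
  rmin-s≡ = trans (cong rmin (sym dupAt-delAt≡s)) (rmin-dupAt t q q<length)

  rank≡rpos : rank ≡ rpos s
  rank≡rpos = increasing-injective (rlminPos s) (rlminPos-increasing s) rank (rpos s)
    (subst (rank <_) (trans (sym rmin-s≡) (rmin≡length-rlminPos s)) rank<rmin) rpos<length
    (trans (subst (λ z → at (rlminPos z) rank ≡ suc q) dupAt-delAt≡s at-rlminPos-dupAt-rank) (proj₁ (proj₂ pair)))

  isAscent-t : isAscent t ≡ true
  isAscent-t = trans (sym (isAscent-dupAt q t q<length)) (subst (λ z → isAscent z ≡ true) (sym dupAt-delAt≡s) (∧≡true⇒ˡ inAstar-s))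

  -- otherwise |s| = rmin(s) + 1, i.e. s ∈ 𝒯₁
  rmin-t≢length : ¬ (rmin t ≡ length t)
  rmin-t≢length h = true≢false (trans (sym (trans (cong (_∧ (length s ≡ᵇ suc (rmin s))) inAstar-s)
    (≡⇒≡ᵇ≡true (trans (sym length-t) (cong suc (trans (sym h) (sym rmin-s≡))))))) inT1-s)

  rpos-t≤rank : rpos t ≤ rank
  rpos-t≤rank = rpos≤rank t q q<length isRLMin-q (isAscent-sound t isAscent-t) rmin-t≢length
    (trans rank≡rpos (cong rpos (sym dupAt-delAt≡s)))

  module D = Duplicate t q q<length isRLMin-q isAscent-t rmin-t≢length rpos-t≤rank

  length-t≡ : length t ≡ n ∸ 1
  length-t≡ = trans (cong pred length-t) (trans (cong pred (proj₂ (proj₂ x))) (pred[n]≡n∸1 n))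
    where
    pred[n]≡n∸1 : ∀ n → pred n ≡ n ∸ 1
    pred[n]≡n∸1 zero = refl
    pred[n]≡n∸1 (suc n) = refl

toCod : ∀ n → Dom n → Cod n
toCod n x = rpos s , delAt (deletionPoint s) s ,
  subst (λ z → T (inAstar (delAt z s))) (sym deletionPoint≡q) (≡true⇒T (rmin≢length⇒inAstar t isAscent-t rmin-t≢length)) ,
  subst (λ z → length (delAt z s) ≡ n ∸ 1) (sym deletionPoint≡q) length-t≡ ,
  subst (λ z → rpos (delAt z s) ≤ rpos s) (sym deletionPoint≡q) (subst (rpos t ≤_) rank≡rpos rpos-t≤rank) ,
  subst (λ z → rpos s < rmin (delAt z s)) (sym deletionPoint≡q) (subst (rpos s <_) rmin-s≡ rpos<rmin)
  where open FromDom n x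

Dom-≡ : ∀ {n} (x y : Dom n) → proj₁ x ≡ proj₁ y → x ≡ y
Dom-≡ (s , a , b) (.s , a' , b') refl = cong₂ (λ u v → s , u , v) (T-irrelevant a a') (≡-irrelevant b b')

Cod-≡ : ∀ {n} (x y : Cod n) → proj₁ x ≡ proj₁ y → proj₁ (proj₂ x) ≡ proj₁ (proj₂ y) → x ≡ y
Cod-≡ (i , t , a , b , c , d) (.i , .t , a' , b' , c' , d') refl refl
  rewrite T-irrelevant a a' | ≡-irrelevant b b' | ≤-irrelevant c c' | <-irrelevant d d' = refl

fromCod∘toCod : ∀ n (2≤n : 2 ≤ n) (x : Dom n) → fromCod n 2≤n (toCod n x) ≡ x
fromCod∘toCod n 2≤n x = Dom-≡ {n} (fromCod n 2≤n (toCod n x)) x (trans (cong₂ dupAt p≡q (cong (λ z → delAt z s) deletionPoint≡q)) dupAt-delAt≡s)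
  where
  open FromDom n x
  p≡q : at (rlminPos (delAt (deletionPoint s) s)) (rpos s) ≡ q
  p≡q = trans (cong (λ z → at (rlminPos (delAt z s)) (rpos s)) deletionPoint≡q)
          (trans (cong (at (rlminPos t)) (sym rank≡rpos)) at-rlminPos-rank)

toCod∘fromCod : ∀ n (2≤n : 2 ≤ n) (y : Cod n) → toCod n (fromCod n 2≤n y) ≡ y
toCod∘fromCod n 2≤n y = Cod-≡ {n} (toCod n (fromCod n 2≤n y)) y (trans rpos-dupAt rank≡i)
  (trans (cong (λ z → delAt (pred z) (dupAt p t)) p′≡suc-p) (delAt-dupAt p t))
  where
  open FromCod n y
  p′≡suc-p : at (rlminPos (dupAt p t)) (rpos (dupAt p t)) ≡ suc p
  p′≡suc-p = trans (cong (at (rlminPos (dupAt p t))) rpos-dupAt) at-rlminPos-dupAt-rank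

statistics-toCod : ∀ n (x : Dom n) → Statistics (proj₁ x) (proj₁ (proj₂ (toCod n x)))
statistics-toCod n x = subst₂ Statistics dupAt-delAt≡s (cong (λ z → delAt z s) (sym deletionPoint≡q)) D.statistics
  where open FromDom n x

lemma15 : (n : ℕ) → 2 ≤ n →
    Σ (Dom n ⤖ Cod n) λ f → (x : Dom n) →
      let s = proj₁ x
          i = proj₁ (Bijection.to f x)
          t = proj₁ (proj₂ (Bijection.to f x))
      in i ≡ rpos s
         × asc s ≡ asc t
         × maxs s ≡ maxs t
         × ealm s ≡ ealm t
         × rmin s ≡ rmin t
         × zeros s ≡ zeros t + χrpos0 s
         × rep s ≡ rep t + 1
lemma15 n 2≤n = ↔⇒⤖ (mk↔ₛ′ (toCod n) (fromCod n 2≤n) (toCod∘fromCod n 2≤n) (fromCod∘toCod n 2≤n)) ,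
  λ x → let open Statistics (statistics-toCod n x) in refl , sasc , smax , sealm , srmin , szero , srep
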